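{- (1) There exists a unique linear map $\Delta_{\mathrm{rec}}:\mathcal H\to\mathcal H\otimes\mathcal H$ satisfying: (a) $\Delta_{\mathrm{rec}}(\mathbf 1)=\mathbf 1\otimes\mathbf 1$; (b) for every $k\ge1$, $\Delta_{\mathrm{rec}}([\{1\}^k])=\sum_{j=0}^k[\{1\}^j]\otimes[\{1\}^{k-j}]$, where $[\{1\}^j]$ denotes $[1,\dots,1]$ with $j$ entries and $[\{1\}^0]:=\mathbf 1$; (c) for every $k\ge1$, every $(s_1,\dots,s_k)\in\mathbb Z_{\ge1}^k$ and every $1\le i\le k$, $$\Delta_{\mathrm{rec}}([s_1,\dots,s_{i-1},s_i+1,s_{i+1},\dots,s_k])=\frac1{s_i}\big(\mathrm{id}\odot D_i+D_i\otimes\mathrm{id}\big)\Delta_{\mathrm{rec}}([s_1,\dots,s_k]).$$ (2) The quintuple $(\mathcal H,\ш_*,\Delta_{\mathrm{rec}},\mathbf 1,\varepsilon)$ is a connected (with respect to the weight grading) bialgebra, and hence a Hopf algebra.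
   Context: Let $\mathcal H$ be the $\mathbb Q$-vector space with basis consisting of a symbol $\mathbf 1$ together with symbols $[\vec s]=[s_1,\dots,s_k]$ for all $k\ge1$ and $\vec s=(s_1,\dots,s_k)\in\mathbb Z_{\ge1}^k$. Write $\operatorname{dep}(\vec s)=k$ (depth) and $|\vec s|=s_1+\dots+s_k$ (weight), with $\operatorname{dep}(\mathbf 1)=|\mathbf 1|=0$; $\mathcal H$ is graded by weight. On $\mathbb Q\langle x_0,x_1\rangle$ (noncommutative polynomials) let $\ш$ be the shuffle product, defined on words by $1\ш w=w\ш 1=w$ and $au\ш bv=a(u\ш bv)+b(au\ш v)$ for letters $a,b$ and words $u,v$. Let $\rho:\mathcal H\to\mathbb Q\langle x_0,x_1\rangle$ be the injective linear map $\rho(\mathbf 1)=1$, $\rho([s_1,\dots,s_k])=x_0^{s_1-1}x_1x_0^{s_2-1}x_1\cdots x_0^{s_k-1}x_1$; its image (spanned by the empty word and words ending in $x_1$) is closed under $\ш$, and $\ш_*$ denotes the product on $\mathcal H$ given by $u\ш_* v:=\rho^{ -1}(\rho(u)\ш\rho(v))$. For $i\ge1$ define linear $\delta_i:\mathcal H\to\mathcal H$ by $\delta_i(\mathbf 1)=0$, $\delta_i[s_1,\dots,s_k]=\sum_{j=1}^i s_j[s_1,\dots,s_j+1,\dots,s_k]$ if $i\le k$ and $=0$ if $i>k$; set $\delta_i=0$ for $i\le0$, and $D_i:=\delta_i-\delta_{i-1}$ for $i\in\mathbb Z$ (so $D_i=0$ for $i\le 0$). For a linear operator $A$ on $\mathcal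 H$ and $i\in\mathbb Z$, the shifted tensor $A\odot D_i:\mathcal H\otimes\mathcal H\to\mathcal H\otimes\mathcal H$ is the linear map $[\vec s]\otimes[\vec t]\mapsto A([\vec s])\otimes D_{i-\operatorname{dep}(\vec s)}([\vec t])$ (basis elements including $\mathbf 1$). The counit $\varepsilon:\mathcal H\to\mathbb Q$ is the linear map with $\varepsilon(\mathbf 1)=1$ and $\varepsilon([\vec s])=0$ for all $\vec s\in\mathbb Z_{\ge1}^k$, $k\ge1$. -}

module Defs where

open import Data.Nat as ℕ using (ℕ; zero; suc; _∸_; _≤_; _≤?_)
open import Data.Integer as ℤ using (ℤ; +_; -[1+_])
open import Data.Rational as ℚ using (ℚ; 0ℚ; 1ℚ)
open import Data.List using (List; []; _∷_; _++_; map; concatMap; length; replicate; take; upTo; foldr; lookup; updateAt)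
import Data.List.Properties as LP
open import Data.Product using (Σ; _×_; _,_; proj₁; proj₂)
import Data.Product.Properties as PP
open import Data.Fin using (Fin; toℕ)
open import Relation.Nullary using (yes; no; ¬_)
open import Relation.Binary.Definitions using (DecidableEquality)
open import Relation.Binary.PropositionalEquality using (_≡_)

-- Basis of 𝓗.
-- ENCODING: an index s : Idx = List ℕ stands for the basis element
-- [suc e₁, …, suc eₖ] (entry e encodes s = e + 1 ≥ 1); the empty list
-- stands for the unit symbol 𝟏.

Idx : Set
Idx = List ℕ

𝟏 : Idx
𝟏 = []

val : ℕ → ℕ
val e = suc e

dep : Idx → ℕ
dep = length

wt : Idx → ℕ
wt s = foldr (λ e n → val e ℕ.+ n) 0 s

ones : ℕ → Idx
ones k = replicate k 0

_≟ᵢ_ : DecidableEquality Idx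
_≟ᵢ_ = LP.≡-dec ℕ._≟_

_≟ᵢ₂_ : DecidableEquality (Idx × Idx)
_≟ᵢ₂_ = PP.≡-dec _≟ᵢ_ _≟ᵢ_

_≟ᵢ₃_ : DecidableEquality (Idx × Idx × Idx)
_≟ᵢ₃_ = PP.≡-dec _≟ᵢ_ _≟ᵢ₂_

-- Finitely supported formal ℚ-linear combinations of elements of B.
-- 𝓗 = Free Idx, 𝓗 ⊗ 𝓗 = Free (Idx × Idx), 𝓗⊗𝓗⊗𝓗 = Free (Idx × Idx × Idx).
-- Two formal sums are equal as vectors iff all coefficients agree.

Free : Set → Set
Free B = List (ℚ × B)

coef : {B : Set} → DecidableEquality B → B → Free B → ℚ
coef _≟_ b [] = 0ℚ
coef _≟_ b ((q , c) ∷ xs) with c ≟ b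
... | yes _ = q ℚ.+ coef _≟_ b xs
... | no  _ = coef _≟_ b xs

EqF : {B : Set} → DecidableEquality B → Free B → Free B → Set
EqF _≟_ x y = ∀ b → coef _≟_ b x ≡ coef _≟_ b y

_≈₁_ : Free Idx → Free Idx → Set
_≈₁_ = EqF _≟ᵢ_

_≈₂_ : Free (Idx × Idx) → Free (Idx × Idx) → Set
_≈₂_ = EqF _≟ᵢ₂_

_≈₃_ : Free (Idx × Idx × Idx) → Free (Idx × Idx × Idx) → Set
_≈₃_ = EqF _≟ᵢ₃_

𝓗 : Set
𝓗 = Free Idx

𝓗⊗𝓗 : Set
𝓗⊗𝓗 = Free (Idx × Idx)

basis : {B : Set} → B → Free B
basis b = (1ℚ , b) ∷ []

scale : {B : Set} → ℚ → Free B → Free B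
scale q = map (λ p → (q ℚ.* proj₁ p , proj₂ p))

_⊕_ : {B : Set} → Free B → Free B → Free B
_⊕_ = _++_

_⊖_ : {B : Set} → Free B → Free B → Free B
x ⊖ y = x ++ scale (ℚ.- 1ℚ) y

lin : {A B : Set} → (A → Free B) → Free A → Free B
lin f = concatMap (λ p → scale (proj₁ p) (f (proj₂ p)))

_⊗ᵥ_ : {A B : Set} → Free A → Free B → Free (A × B)
x ⊗ᵥ y = concatMap (λ p → map (λ r → (proj₁ p ℚ.* proj₁ r , (proj₂ p , proj₂ r))) y) x

_⊗ₘ_ : {A A' B B' : Set} → (A → Free A') → (B → Free B') → (A × B) → Free (A' × B')
(f ⊗ₘ g) (a , b) = f a ⊗ᵥ g b

sumℚ : List ℚ → ℚ
sumℚ = foldr ℚ._+_ 0ℚ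

-- bumps s = list over positions j = 1..k of  s_j [s₁,…,s_j+1,…,s_k]
bumps : Idx → 𝓗
bumps [] = []
bumps (e ∷ s) = ((+ val e) ℚ./ 1 , (suc e ∷ s)) ∷ map (λ p → (proj₁ p , e ∷ proj₂ p)) (bumps s)

δℕ : ℕ → Idx → 𝓗
δℕ i s with i ≤? dep s
... | yes _ = take i (bumps s)
... | no  _ = []

-- δ_i (δ_i = 0 for i ≤ 0; note δℕ 0 = 0 as well)
δ : ℤ → Idx → 𝓗
δ (+ n) = δℕ n
δ -[1+ n ] = λ _ → []

D : ℤ → Idx → 𝓗
D i s = δ i s ⊖ δ (i ℤ.- ℤ.1ℤ) s

_⊙D_ : (Idx → 𝓗) → ℤ → (Idx × Idx) → 𝓗⊗𝓗
(A ⊙D i) (s , t) = A s ⊗ᵥ D (i ℤ.- (+ dep s)) t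

D⊗id : ℤ → (Idx × Idx) → 𝓗⊗𝓗
D⊗id i = D i ⊗ₘ basis

data Letter : Set where
  x₀ x₁ : Letter

Word : Set
Word = List Letter

sh : Word → Word → List Word
sh [] v = v ∷ []
sh u@(_ ∷ _) [] = u ∷ []
sh (a ∷ u) (b ∷ v) = map (a ∷_) (sh u (b ∷ v)) ++ map (b ∷_) (sh (a ∷ u) v)

ρ : Idx → Word
ρ [] = []
ρ (e ∷ s) = replicate e x₀ ++ (x₁ ∷ ρ s)

-- left inverse of ρ (ρ⁻¹ on the image of ρ, which is closed under ш)
ρ⁻¹-aux : ℕ → Word → Idx
ρ⁻¹-aux n [] = []
ρ⁻¹-aux n (x₀ ∷ w) = ρ⁻¹-aux (suc n) w
ρ⁻¹-aux n (x₁ ∷ w) = n ∷ ρ⁻¹-aux 0 w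

ρ⁻¹ : Word → Idx
ρ⁻¹ = ρ⁻¹-aux 0

shB : Idx → Idx → 𝓗
shB s t = map (λ w → (1ℚ , ρ⁻¹ w)) (sh (ρ s) (ρ t))

_ш*_ : 𝓗 → 𝓗 → 𝓗
x ш* y = lin (λ s → lin (shB s) y) x

_ш⊗_ : 𝓗⊗𝓗 → 𝓗⊗𝓗 → 𝓗⊗𝓗
X ш⊗ Y = lin (λ ab → lin (λ cd → shB (proj₁ ab) (proj₁ cd) ⊗ᵥ shB (proj₂ ab) (proj₂ cd)) Y) X

ε : Idx → ℚ
ε [] = 1ℚ
ε (_ ∷ _) = 0ℚ

εₗ : 𝓗 → ℚ
εₗ x = sumℚ (map (λ p → proj₁ p ℚ.* ε (proj₂ p)) x)

IsΔrec : (Idx → 𝓗⊗𝓗) → Set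
IsΔrec Δ =
  (Δ 𝟏 ≈₂ basis (𝟏 , 𝟏))
  × (∀ k → 1 ≤ k →
       Δ (ones k) ≈₂ map (λ j → (1ℚ , (ones j , ones (k ∸ j)))) (upTo (suc k)))
  -- (c)  position i (1-based) is toℕ i + 1, s_i = val (lookup s i)
  × (∀ (s : Idx) (i : Fin (dep s)) →
       Δ (updateAt s i suc)
         ≈₂ scale ((+ 1) ℚ./ val (lookup s i))
                  (lin (λ p → (basis ⊙D (+ suc (toℕ i))) p ⊕ D⊗id (+ suc (toℕ i)) p) (Δ s)))

assocL : {A B C : Set} → Free ((A × B) × C) → Free (A × B × C)
assocL = map (λ p → (proj₁ p , (proj₁ (proj₁ (proj₂ p)) , (proj₂ (proj₁ (proj₂ p)) , proj₂ (proj₂ p)))))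

IsConnectedBialgebra : (Idx → 𝓗⊗𝓗) → Set
IsConnectedBialgebra Δ =
  (∀ x y z → ((x ш* y) ш* z) ≈₁ (x ш* (y ш* z)))
  × (∀ x → (basis 𝟏 ш* x) ≈₁ x)
  × (∀ x → (x ш* basis 𝟏) ≈₁ x)
  × (∀ s → assocL (lin (Δ ⊗ₘ basis) (Δ s)) ≈₃ lin (basis ⊗ₘ Δ) (Δ s))
  × (∀ s → lin (λ ab → scale (ε (proj₁ ab)) (basis (proj₂ ab))) (Δ s) ≈₁ basis s)
  × (∀ s → lin (λ ab → scale (ε (proj₂ ab)) (basis (proj₁ ab))) (Δ s) ≈₁ basis s)
  × (∀ x y → lin Δ (x ш* y) ≈₂ (lin Δ x ш⊗ lin Δ y))
  × (Δ 𝟏 ≈₂ basis (𝟏 , 𝟏))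
  × (∀ x y → εₗ (x ш* y) ≡ εₗ x ℚ.* εₗ y)
  × (ε 𝟏 ≡ 1ℚ)
  × (∀ s t w → ¬ (coef _≟ᵢ_ w (shB s t) ≡ 0ℚ) → wt w ≡ wt s ℕ.+ wt t)
  × (∀ s a b → ¬ (coef _≟ᵢ₂_ (a , b) (Δ s) ≡ 0ℚ) → wt a ℕ.+ wt b ≡ wt s)
  × (∀ s → ¬ (ε s ≡ 0ℚ) → wt s ≡ 0)
  × (∀ s → wt s ≡ 0 → s ≡ 𝟏)

HasAntipode : (Idx → 𝓗⊗𝓗) → Set
HasAntipode Δ = Σ (Idx → 𝓗) λ S →
  (∀ s → lin (λ ab → S (proj₁ ab) ш* basis (proj₂ ab)) (Δ s) ≈₁ scale (ε s) (basis 𝟏))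
  × (∀ s → lin (λ ab → basis (proj₁ ab) ш* S (proj₂ ab)) (Δ s) ≈₁ scale (ε s) (basis 𝟏))

-- Through ρ, 𝓗 is the span of 𝟏 and the words ending in x₁, a complement
-- of the shuffle ideal I = x₀ ш ℚ⟨x₀,x₁⟩. The projection reg along I is a
-- morphism of shuffle algebras, and I is a coideal for deconcatenation
-- since x₀ is primitive; so 𝓗 ≅ ℚ⟨x₀,x₁⟩ / I inherits the Hopf algebra
-- structure of the shuffle algebra with deconcatenation, with
-- Δrec = (reg ⊗ reg) ∘ Δ ∘ ρ and antipode reg ∘ (w ↦ (-1)^|w| reverse w).
-- Under ρ, δᵢ becomes the operator inserting one x₀ in front of the letters
-- up to the i-th x₁; it commutes with x₀ ш - and is a coderivation of
-- deconcatenation, which gives (c). Uniqueness holds because every index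
-- arises from some [{1}^k] by repeatedly raising one entry.

{-# OPTIONS --safe #-}
module Submission where

open import Defs
open import Data.Nat as ℕ using (ℕ; zero; suc; _+_; _∸_; _≤?_)
import Data.Nat.Properties as NP
open import Data.Nat.Coprimality using (Coprime; 1-coprimeTo)
import Data.Nat.Coprimality as Cop
open import Data.Integer as ℤ using (ℤ; +_; -[1+_])
import Data.Integer.Properties as ZP
open import Data.Integer.Tactic.RingSolver using (solve-∀)
open import Data.Rational as ℚ using (ℚ; 0ℚ; 1ℚ; mkℚ)
import Data.Rational.Properties as QP
import Data.Rational.Unnormalised as U
import Data.Rational.Unnormalised.Properties as UP
open import Data.Rational.Solver
open +-*-Solver
open import Data.List using (List; []; _∷_; [_]; _++_; map; filter; length; replicate; reverse; take; lookup; updateAt; upTo; applyUpTo)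
import Data.List.Properties as LP
open import Data.List.Relation.Unary.All as All using (All; []; _∷_)
import Data.List.Relation.Unary.All.Properties as AllP
open import Data.Fin using (Fin; toℕ) renaming (zero to fz; suc to fs)
import Data.Fin.Properties as FP
open import Data.Product using (Σ; _×_; _,_; proj₁; proj₂)
open import Data.Sum using (_⊎_; inj₁; inj₂)
open import Data.Empty using (⊥-elim)
open import Function using (_∘_)
open import Relation.Nullary using (yes; no; ¬_; ¬?)
open import Relation.Binary.Definitions using (DecidableEquality)
open import Relation.Binary.PropositionalEquality hiding ([_])

private
  variable
    A B : Set

-- Vectors are compared through their values on all functionals; this
-- coincides with the coefficientwise EqF (≋⇒≈, ≈⇒≋) but is respected by
-- all linear operations for free.
opaque
  pair : Free B → (B → ℚ) → ℚ
  pair [] g = 0ℚ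
  pair ((q , c) ∷ x) g = q ℚ.* g c ℚ.+ pair x g

infix 4 _≋_

_≋_ : Free B → Free B → Set
x ≋ y = ∀ g → pair x g ≡ pair y g

≋-refl : {x : Free B} → x ≋ x
≋-refl g = refl

≋-sym : {x y : Free B} → x ≋ y → y ≋ x
≋-sym p g = sym (p g)

≋-trans : {x y z : Free B} → x ≋ y → y ≋ z → x ≋ z
≋-trans p q g = trans (p g) (q g)

Supported : (B → Set) → Free B → Set
Supported P x = All (P ∘ proj₂) x

Σlist : List A → (A → ℚ) → ℚ
Σlist [] g = 0ℚ
Σlist (a ∷ l) g = g a ℚ.+ Σlist l g

formalSum : List A → Free A
formalSum = map (1ℚ ,_)

opaque
  unfolding pair

  pair-[] : (g : B → ℚ) → pair [] g ≡ 0ℚ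
  pair-[] g = refl

  pair-∷ : (q : ℚ) (c : B) (x : Free B) (g : B → ℚ) → pair ((q , c) ∷ x) g ≡ q ℚ.* g c ℚ.+ pair x g
  pair-∷ q c x g = refl

  pair-++ : (x y : Free B) (g : B → ℚ) → pair (x ++ y) g ≡ pair x g ℚ.+ pair y g
  pair-++ [] y g = sym (QP.+-identityˡ (pair y g))
  pair-++ ((q , c) ∷ x) y g rewrite pair-++ x y g = sym (QP.+-assoc (q ℚ.* g c) (pair x g) (pair y g))

  pair-scale : (r : ℚ) (x : Free B) (g : B → ℚ) → pair (scale r x) g ≡ r ℚ.* pair x g
  pair-scale r [] g = sym (QP.*-zeroʳ r)
  pair-scale r ((q , c) ∷ x) g rewrite pair-scale r x g =
    solve 4 (λ r q a b → r :* q :* a :+ r :* b := r :* (q :* a :+ b)) refl r q (g c) (pair x g)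

  pair-basis : (c : B) (g : B → ℚ) → pair (basis c) g ≡ g c
  pair-basis c g = solve 1 (λ a → con 1ℚ :* a :+ con 0ℚ := a) refl (g c)

  pair-ext : (x : Free B) {g h : B → ℚ} → (∀ c → g c ≡ h c) → pair x g ≡ pair x h
  pair-ext [] e = refl
  pair-ext ((q , c) ∷ x) e = cong₂ (λ a b → q ℚ.* a ℚ.+ b) (e c) (pair-ext x e)

  pair-supp : {P : B → Set} {x : Free B} → Supported P x → {g h : B → ℚ} →
              (∀ c → P c → g c ≡ h c) → pair x g ≡ pair x h
  pair-supp [] e = refl
  pair-supp {x = (q , c) ∷ x} (p ∷ s) e = cong₂ (λ a b → q ℚ.* a ℚ.+ b) (e c p) (pair-supp s e)

  pair-+ : (x : Free B) (g h : B → ℚ) → pair x (λ c → g c ℚ.+ h c) ≡ pair x g ℚ.+ pair x h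
  pair-+ [] g h = refl
  pair-+ ((q , c) ∷ x) g h rewrite pair-+ x g h =
    solve 5 (λ q a b u v → q :* (a :+ b) :+ (u :+ v) := (q :* a :+ u) :+ (q :* b :+ v))
      refl q (g c) (h c) (pair x g) (pair x h)

  pair-* : (r : ℚ) (x : Free B) (g : B → ℚ) → pair x (λ c → r ℚ.* g c) ≡ r ℚ.* pair x g
  pair-* r [] g = sym (QP.*-zeroʳ r)
  pair-* r ((q , c) ∷ x) g rewrite pair-* r x g =
    solve 4 (λ r q a b → q :* (r :* a) :+ r :* b := r :* (q :* a :+ b)) refl r q (g c) (pair x g)

  pair-0 : (x : Free B) → pair x (λ _ → 0ℚ) ≡ 0ℚ
  pair-0 [] = refl
  pair-0 ((q , c) ∷ x) rewrite pair-0 x = solve 1 (λ q → q :* con 0ℚ :+ con 0ℚ := con 0ℚ) refl q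

  pair-neg : (x : Free B) (g : B → ℚ) → pair x (λ c → ℚ.- g c) ≡ ℚ.- pair x g
  pair-neg [] g = refl
  pair-neg ((q , c) ∷ x) g rewrite pair-neg x g =
    solve 3 (λ q a b → q :* (:- a) :+ (:- b) := :- (q :* a :+ b)) refl q (g c) (pair x g)

  pair-map : (f : A → B) (x : Free A) (g : B → ℚ) →
             pair (map (λ p → (proj₁ p , f (proj₂ p))) x) g ≡ pair x (g ∘ f)
  pair-map f [] g = refl
  pair-map f ((q , c) ∷ x) g = cong (q ℚ.* g (f c) ℚ.+_) (pair-map f x g)

  pair-⊗ : (x : Free A) (y : Free B) (h : A × B → ℚ) → pair (x ⊗ᵥ y) h ≡ pair x (λ a → pair y (λ b → h (a , b)))
  pair-⊗ [] y h = refl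
  pair-⊗ ((q , a) ∷ x) y h =
    trans (pair-++ (map (λ r → (q ℚ.* proj₁ r , (a , proj₂ r))) y) (x ⊗ᵥ y) h)
          (cong₂ ℚ._+_ (pair-row y) (pair-⊗ x y h))
    where
    pair-row : ∀ y → pair (map (λ r → (q ℚ.* proj₁ r , (a , proj₂ r))) y) h ≡ q ℚ.* pair y (λ b → h (a , b))
    pair-row [] = sym (QP.*-zeroʳ q)
    pair-row ((r , b) ∷ y) rewrite pair-row y =
      solve 4 (λ q r u v → q :* r :* u :+ q :* v := q :* (r :* u :+ v)) refl q r (h (a , b)) (pair y (λ b → h (a , b)))

  pair-formalSum : (l : List A) (g : A → ℚ) → pair (formalSum l) g ≡ Σlist l g
  pair-formalSum [] g = refl
  pair-formalSum (a ∷ l) g = cong₂ ℚ._+_ (QP.*-identityˡ (g a)) (pair-formalSum l g)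

  sumℚ-pair : (x : Free B) (f : B → ℚ) → sumℚ (map (λ p → proj₁ p ℚ.* f (proj₂ p)) x) ≡ pair x f
  sumℚ-pair [] f = refl
  sumℚ-pair ((q , c) ∷ x) f = cong (q ℚ.* f c ℚ.+_) (sumℚ-pair x f)

  pair-swap : (x : Free A) (y : Free B) (φ : A → B → ℚ) →
              pair x (λ a → pair y (φ a)) ≡ pair y (λ b → pair x (λ a → φ a b))
  pair-swap [] y φ = sym (pair-0 y)
  pair-swap ((q , a) ∷ x) y φ rewrite pair-swap x y φ =
    trans (cong (ℚ._+ pair y (λ b → pair x (λ a → φ a b))) (sym (pair-* q y (φ a))))
          (sym (pair-+ y (λ b → q ℚ.* φ a b) (λ b → pair x (λ a → φ a b))))

  Σlist-pair-swap : (l : List A) (x : Free B) (φ : A → B → ℚ) →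
                    Σlist l (λ a → pair x (φ a)) ≡ pair x (λ b → Σlist l (λ a → φ a b))
  Σlist-pair-swap [] x φ = sym (pair-0 x)
  Σlist-pair-swap (a ∷ l) x φ rewrite Σlist-pair-swap l x φ =
    sym (pair-+ x (φ a) (λ b → Σlist l (λ a → φ a b)))

pair-minus : (x : Free B) (g h : B → ℚ) → pair x (λ c → g c ℚ.- h c) ≡ pair x g ℚ.- pair x h
pair-minus x g h = trans (pair-+ x g (λ c → ℚ.- h c)) (cong (pair x g ℚ.+_) (pair-neg x h))

pair-⊖ : (x y : Free B) (g : B → ℚ) → pair (x ⊖ y) g ≡ pair x g ℚ.- pair y g
pair-⊖ x y g = trans (pair-++ x _ g) (cong (pair x g ℚ.+_)
  (trans (pair-scale (ℚ.- 1ℚ) y g) (solve 1 (λ a → con (ℚ.- 1ℚ) :* a := :- a) refl (pair y g))))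

pair-lin : (f : A → Free B) (x : Free A) (g : B → ℚ) → pair (lin f x) g ≡ pair x (λ c → pair (f c) g)
pair-lin f [] g = trans (pair-[] g) (sym (pair-[] _))
pair-lin f ((q , c) ∷ x) g = begin
    pair (scale q (f c) ++ lin f x) g                   ≡⟨ pair-++ (scale q (f c)) (lin f x) g ⟩
    pair (scale q (f c)) g ℚ.+ pair (lin f x) g         ≡⟨ cong₂ ℚ._+_ (pair-scale q (f c) g) (pair-lin f x g) ⟩
    q ℚ.* pair (f c) g ℚ.+ pair x (λ c → pair (f c) g)  ≡⟨ sym (pair-∷ q c x _) ⟩
    pair ((q , c) ∷ x) (λ c → pair (f c) g)             ∎
  where open ≡-Reasoning

scale-cong : (r : ℚ) {x y : Free B} → x ≋ y → scale r x ≋ scale r y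
scale-cong r {x} {y} p g = trans (pair-scale r x g) (trans (cong (r ℚ.*_) (p g)) (sym (pair-scale r y g)))

lin-cong : {f f' : A → Free B} {x x' : Free A} → (∀ c → f c ≋ f' c) → x ≋ x' → lin f x ≋ lin f' x'
lin-cong {f = f} {f'} {x} {x'} e p g =
  trans (pair-lin f x g) (trans (pair-ext x (λ c → e c g)) (trans (p _) (sym (pair-lin f' x' g))))

supp-lin : {P : A → Set} {Q : B → Set} (f : A → Free B) {x : Free A} →
           Supported P x → (∀ c → P c → Supported Q (f c)) → Supported Q (lin f x)
supp-lin f [] h = []
supp-lin f {(q , c) ∷ x} (p ∷ s) h = AllP.++⁺ (AllP.map⁺ (h c p)) (supp-lin f s h)

supp-⊗ : {P : A → Set} {Q : B → Set} {x : Free A} {y : Free B} →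
         Supported P x → Supported Q y → Supported (λ ab → P (proj₁ ab) × Q (proj₂ ab)) (x ⊗ᵥ y)
supp-⊗ [] sy = []
supp-⊗ (p ∷ sx) sy = AllP.++⁺ (AllP.map⁺ (All.map (p ,_) sy)) (supp-⊗ sx sy)

module _ (_≟_ : DecidableEquality B) where

  indicator : B → B → ℚ
  indicator b c with c ≟ b
  ... | yes _ = 1ℚ
  ... | no _ = 0ℚ

  opaque
    unfolding pair

    coef-pair : ∀ b x → coef _≟_ b x ≡ pair x (indicator b)
    coef-pair b [] = refl
    coef-pair b ((q , c) ∷ x) with c ≟ b
    ... | yes _ = cong₂ ℚ._+_ (sym (QP.*-identityʳ q)) (coef-pair b x)
    ... | no _ = trans (coef-pair b x) (sym (trans (cong (ℚ._+ pair x (indicator b)) (QP.*-zeroʳ q)) (QP.+-identityˡ _)))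

    coef≢0⇒supported : {P : B → Set} {x : Free B} → Supported P x → ∀ b → ¬ (coef _≟_ b x ≡ 0ℚ) → P b
    coef≢0⇒supported {x = []} s b nz = ⊥-elim (nz refl)
    coef≢0⇒supported {x = (q , c) ∷ x} (p ∷ s) b nz with c ≟ b
    ... | yes refl = p
    ... | no _ = coef≢0⇒supported s b nz

    dropAt : B → Free B → Free B
    dropAt c = filter (λ p → ¬? (proj₂ p ≟ c))

    pair-dropAt : ∀ c x g → pair x g ≡ coef _≟_ c x ℚ.* g c ℚ.+ pair (dropAt c x) g
    pair-dropAt c [] g = sym (trans (cong (ℚ._+ 0ℚ) (QP.*-zeroˡ (g c))) (QP.+-identityʳ 0ℚ))
    pair-dropAt c ((q , d) ∷ x) g with d ≟ c
    ... | yes refl rewrite pair-dropAt d x g =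
      solve 4 (λ q a k t → q :* a :+ (k :* a :+ t) := (q :+ k) :* a :+ t) refl q (g d) (coef _≟_ d x) (pair (dropAt d x) g)
    ... | no _ rewrite pair-dropAt c x g =
      solve 4 (λ u k a t → u :+ (k :* a :+ t) := k :* a :+ (u :+ t)) refl (q ℚ.* g d) (coef _≟_ c x) (g c) (pair (dropAt c x) g)

    coef-dropAt-self : ∀ c x → coef _≟_ c (dropAt c x) ≡ 0ℚ
    coef-dropAt-self c [] = refl
    coef-dropAt-self c ((q , d) ∷ x) with d ≟ c
    ... | yes _ = coef-dropAt-self c x
    ... | no d≢c with d ≟ c
    ...   | yes d≡c = ⊥-elim (d≢c d≡c)
    ...   | no _ = coef-dropAt-self c x

    coef-dropAt : ∀ c x b → ¬ (b ≡ c) → coef _≟_ b (dropAt c x) ≡ coef _≟_ b x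
    coef-dropAt c [] b b≢c = refl
    coef-dropAt c ((q , d) ∷ x) b b≢c with d ≟ c
    ... | yes refl with d ≟ b
    ...   | yes refl = ⊥-elim (b≢c refl)
    ...   | no _ = coef-dropAt c x b b≢c
    coef-dropAt c ((q , d) ∷ x) b b≢c | no _ with d ≟ b
    ...   | yes _ = cong (q ℚ.+_) (coef-dropAt c x b b≢c)
    ...   | no _ = coef-dropAt c x b b≢c

    length-dropAt : ∀ q c x → length (dropAt c ((q , c) ∷ x)) ℕ.≤ length x
    length-dropAt q c x with c ≟ c
    ... | yes _ = LP.length-filter _ x
    ... | no c≢c = ⊥-elim (c≢c refl)

    coef-0⇒pair-0 : ∀ n (x : Free B) → length x ℕ.≤ n → (∀ b → coef _≟_ b x ≡ 0ℚ) → ∀ g → pair x g ≡ 0ℚ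
    coef-0⇒pair-0 _ [] _ _ g = refl
    coef-0⇒pair-0 (suc n) x@((q , c) ∷ x') (ℕ.s≤s le) z g = begin
        pair x g                                      ≡⟨ pair-dropAt c x g ⟩
        coef _≟_ c x ℚ.* g c ℚ.+ pair (dropAt c x) g  ≡⟨ cong₂ (λ k t → k ℚ.* g c ℚ.+ t) (z c) rest ⟩
        0ℚ ℚ.* g c ℚ.+ 0ℚ                             ≡⟨ solve 1 (λ a → con 0ℚ :* a :+ con 0ℚ := con 0ℚ) refl (g c) ⟩
        0ℚ                                            ∎
      where
      open ≡-Reasoning
      coef-rest : ∀ b → coef _≟_ b (dropAt c x) ≡ 0ℚ
      coef-rest b with b ≟ c
      ... | yes refl = coef-dropAt-self b x
      ... | no b≢c = trans (coef-dropAt c x b b≢c) (z b)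
      rest : pair (dropAt c x) g ≡ 0ℚ
      rest = coef-0⇒pair-0 n (dropAt c x) (NP.≤-trans (length-dropAt q c x') le) coef-rest g

  ≋⇒≈ : {x y : Free B} → x ≋ y → EqF _≟_ x y
  ≋⇒≈ {x} {y} p b = trans (coef-pair b x) (trans (p (indicator b)) (sym (coef-pair b y)))

  ≈⇒≋ : {x y : Free B} → EqF _≟_ x y → x ≋ y
  ≈⇒≋ {x} {y} e g = begin
      pair x g                               ≡⟨ solve 2 (λ a b → a := (a :- b) :+ b) refl (pair x g) (pair y g) ⟩
      (pair x g ℚ.- pair y g) ℚ.+ pair y g   ≡⟨ cong (ℚ._+ pair y g) (sym (pair-⊖ x y g)) ⟩
      pair (x ⊖ y) g ℚ.+ pair y g            ≡⟨ cong (ℚ._+ pair y g) (coef-0⇒pair-0 _ (x ⊖ y) NP.≤-refl coef-diff g) ⟩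
      0ℚ ℚ.+ pair y g                        ≡⟨ QP.+-identityˡ _ ⟩
      pair y g                               ∎
    where
    open ≡-Reasoning
    coef-diff : ∀ b → coef _≟_ b (x ⊖ y) ≡ 0ℚ
    coef-diff b = begin
      coef _≟_ b (x ⊖ y)                               ≡⟨ coef-pair b (x ⊖ y) ⟩
      pair (x ⊖ y) (indicator b)                       ≡⟨ pair-⊖ x y (indicator b) ⟩
      pair x (indicator b) ℚ.- pair y (indicator b)    ≡⟨ cong₂ ℚ._-_ (sym (coef-pair b x)) (sym (coef-pair b y)) ⟩
      coef _≟_ b x ℚ.- coef _≟_ b y                    ≡⟨ cong (λ t → coef _≟_ b x ℚ.- t) (sym (e b)) ⟩
      coef _≟_ b x ℚ.- coef _≟_ b x                    ≡⟨ QP.+-inverseʳ (coef _≟_ b x) ⟩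
      0ℚ                                               ∎

Σlist-++ : (l m : List A) (g : A → ℚ) → Σlist (l ++ m) g ≡ Σlist l g ℚ.+ Σlist m g
Σlist-++ [] m g = sym (QP.+-identityˡ _)
Σlist-++ (a ∷ l) m g rewrite Σlist-++ l m g = sym (QP.+-assoc (g a) (Σlist l g) (Σlist m g))

Σlist-map : (f : A → B) (l : List A) (g : B → ℚ) → Σlist (map f l) g ≡ Σlist l (g ∘ f)
Σlist-map f [] g = refl
Σlist-map f (a ∷ l) g = cong (g (f a) ℚ.+_) (Σlist-map f l g)

Σlist-supp : {P : A → Set} {l : List A} → All P l → {g h : A → ℚ} → (∀ a → P a → g a ≡ h a) → Σlist l g ≡ Σlist l h
Σlist-supp [] e = refl
Σlist-supp {l = a ∷ l} (p ∷ ps) e = cong₂ ℚ._+_ (e a p) (Σlist-supp ps e)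

Σlist-ext : (l : List A) {g h : A → ℚ} → (∀ a → g a ≡ h a) → Σlist l g ≡ Σlist l h
Σlist-ext [] e = refl
Σlist-ext (a ∷ l) e = cong₂ ℚ._+_ (e a) (Σlist-ext l e)

Σlist-+ : (l : List A) (g h : A → ℚ) → Σlist l (λ a → g a ℚ.+ h a) ≡ Σlist l g ℚ.+ Σlist l h
Σlist-+ [] g h = sym (QP.+-identityˡ 0ℚ)
Σlist-+ (a ∷ l) g h rewrite Σlist-+ l g h =
  solve 4 (λ a b u v → (a :+ b) :+ (u :+ v) := (a :+ u) :+ (b :+ v)) refl (g a) (h a) (Σlist l g) (Σlist l h)

Σlist-* : (r : ℚ) (l : List A) (g : A → ℚ) → Σlist l (λ a → r ℚ.* g a) ≡ r ℚ.* Σlist l g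
Σlist-* r [] g = sym (QP.*-zeroʳ r)
Σlist-* r (a ∷ l) g rewrite Σlist-* r l g = sym (QP.*-distribˡ-+ r (g a) (Σlist l g))

Σlist-neg : (l : List A) (g : A → ℚ) → Σlist l (λ a → ℚ.- g a) ≡ ℚ.- Σlist l g
Σlist-neg [] g = refl
Σlist-neg (a ∷ l) g rewrite Σlist-neg l g = sym (QP.neg-distrib-+ (g a) (Σlist l g))

Σlist-0 : (l : List A) → Σlist l (λ _ → 0ℚ) ≡ 0ℚ
Σlist-0 [] = refl
Σlist-0 (a ∷ l) rewrite Σlist-0 l = QP.+-identityˡ 0ℚ

opaque
  Σш : Word → Word → (Word → ℚ) → ℚ
  Σш u v g = Σlist (sh u v) g

  Σш-[]ˡ : ∀ v g → Σш [] v g ≡ g v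
  Σш-[]ˡ v g = QP.+-identityʳ (g v)

  Σш-[]ʳ : ∀ u g → Σш u [] g ≡ g u
  Σш-[]ʳ [] g = QP.+-identityʳ (g [])
  Σш-[]ʳ (a ∷ u) g = QP.+-identityʳ (g (a ∷ u))

  Σш-∷ : ∀ a u b v g → Σш (a ∷ u) (b ∷ v) g ≡ Σш u (b ∷ v) (g ∘ (a ∷_)) ℚ.+ Σш (a ∷ u) v (g ∘ (b ∷_))
  Σш-∷ a u b v g =
    trans (Σlist-++ (map (a ∷_) (sh u (b ∷ v))) (map (b ∷_) (sh (a ∷ u) v)) g)
          (cong₂ ℚ._+_ (Σlist-map (a ∷_) (sh u (b ∷ v)) g) (Σlist-map (b ∷_) (sh (a ∷ u) v) g))

  Σш-supp : {P : Word → Set} (u v : Word) → All P (sh u v) → {g h : Word → ℚ} →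
            (∀ w → P w → g w ≡ h w) → Σш u v g ≡ Σш u v h
  Σш-supp u v = Σlist-supp

  Σш-ext : ∀ u v {g h} → (∀ w → g w ≡ h w) → Σш u v g ≡ Σш u v h
  Σш-ext u v = Σlist-ext (sh u v)

  Σш-+ : ∀ u v g h → Σш u v (λ w → g w ℚ.+ h w) ≡ Σш u v g ℚ.+ Σш u v h
  Σш-+ u v = Σlist-+ (sh u v)

  Σш-* : ∀ r u v g → Σш u v (λ w → r ℚ.* g w) ≡ r ℚ.* Σш u v g
  Σш-* r u v = Σlist-* r (sh u v)

  Σш-0 : ∀ u v → Σш u v (λ _ → 0ℚ) ≡ 0ℚ
  Σш-0 u v = Σlist-0 (sh u v)

  Σш-pair-swap : (u v : Word) (x : Free B) (φ : Word → B → ℚ) →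
                 Σш u v (λ w → pair x (φ w)) ≡ pair x (λ c → Σш u v (λ w → φ w c))
  Σш-pair-swap u v = Σlist-pair-swap (sh u v)

  pair-formalSum-sh : ∀ u v g → pair (formalSum (sh u v)) g ≡ Σш u v g
  pair-formalSum-sh u v = pair-formalSum (sh u v)

Σш-∷-ext : ∀ a u b v {g : Word → ℚ} (k₁ k₂ : Word → ℚ) →
  (∀ w → g (a ∷ w) ≡ k₁ w) → (∀ w → g (b ∷ w) ≡ k₂ w) →
  Σш (a ∷ u) (b ∷ v) g ≡ Σш u (b ∷ v) k₁ ℚ.+ Σш (a ∷ u) v k₂
Σш-∷-ext a u b v {g} k₁ k₂ e₁ e₂ =
  trans (Σш-∷ a u b v g) (cong₂ ℚ._+_ (Σш-ext u (b ∷ v) e₁) (Σш-ext (a ∷ u) v e₂))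

Σш-comm : ∀ u v g → Σш u v g ≡ Σш v u g
Σш-comm [] v g = trans (Σш-[]ˡ v g) (sym (Σш-[]ʳ v g))
Σш-comm (a ∷ u) [] g = trans (Σш-[]ʳ (a ∷ u) g) (sym (Σш-[]ˡ (a ∷ u) g))
Σш-comm (a ∷ u) (b ∷ v) g = begin
    Σш (a ∷ u) (b ∷ v) g                                   ≡⟨ Σш-∷ a u b v g ⟩
    Σш u (b ∷ v) (g ∘ (a ∷_)) ℚ.+ Σш (a ∷ u) v (g ∘ (b ∷_)) ≡⟨ cong₂ ℚ._+_ (Σш-comm u (b ∷ v) _) (Σш-comm (a ∷ u) v _) ⟩
    Σш (b ∷ v) u (g ∘ (a ∷_)) ℚ.+ Σш v (a ∷ u) (g ∘ (b ∷_)) ≡⟨ QP.+-comm (Σш (b ∷ v) u (g ∘ (a ∷_))) _ ⟩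
    Σш v (a ∷ u) (g ∘ (b ∷_)) ℚ.+ Σш (b ∷ v) u (g ∘ (a ∷_)) ≡⟨ sym (Σш-∷ b v a u g) ⟩
    Σш (b ∷ v) (a ∷ u) g                                   ∎
  where open ≡-Reasoning

Σш-assoc : ∀ u v w g → Σш u v (λ x → Σш x w g) ≡ Σш v w (λ y → Σш u y g)
Σш-assoc [] v w g = trans (Σш-[]ˡ v (λ x → Σш x w g)) (Σш-ext v w (λ y → sym (Σш-[]ˡ y g)))
Σш-assoc (a ∷ u) [] w g = trans (Σш-[]ʳ (a ∷ u) (λ x → Σш x w g)) (sym (Σш-[]ˡ w (λ y → Σш (a ∷ u) y g)))
Σш-assoc (a ∷ u) (b ∷ v) [] g =
  trans (Σш-ext (a ∷ u) (b ∷ v) (λ x → Σш-[]ʳ x g)) (sym (Σш-[]ʳ (b ∷ v) (λ y → Σш (a ∷ u) y g)))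
Σш-assoc (a ∷ u) (b ∷ v) (c ∷ w) g = begin
    Σш (a ∷ u) (b ∷ v) (λ x → Σш x (c ∷ w) g)
  ≡⟨ Σш-∷-ext a u b v _ _ (λ x → Σш-∷ a x c w g) (λ x → Σш-∷ b x c w g) ⟩
    Σш u (b ∷ v) (λ x → Σш x (c ∷ w) ga ℚ.+ Σш (a ∷ x) w gc) ℚ.+
    Σш (a ∷ u) v (λ x → Σш x (c ∷ w) gb ℚ.+ Σш (b ∷ x) w gc)
  ≡⟨ cong₂ ℚ._+_ (Σш-+ u (b ∷ v) _ _) (Σш-+ (a ∷ u) v _ _) ⟩
    (P₁ ℚ.+ P₂) ℚ.+ (P₃ ℚ.+ P₄)
  ≡⟨ solve 4 (λ p₁ p₂ p₃ p₄ → (p₁ :+ p₂) :+ (p₃ :+ p₄) := p₁ :+ (p₃ :+ (p₂ :+ p₄))) refl P₁ P₂ P₃ P₄ ⟩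
    P₁ ℚ.+ (P₃ ℚ.+ (P₂ ℚ.+ P₄))
  ≡⟨ cong (λ z → P₁ ℚ.+ (P₃ ℚ.+ z)) (sym (Σш-∷ a u b v (λ x → Σш x w gc))) ⟩
    P₁ ℚ.+ (P₃ ℚ.+ Σш (a ∷ u) (b ∷ v) (λ x → Σш x w gc))
  ≡⟨ cong₂ (λ z t → z ℚ.+ (t ℚ.+ Σш (a ∷ u) (b ∷ v) (λ x → Σш x w gc)))
           (Σш-assoc u (b ∷ v) (c ∷ w) ga) (Σш-assoc (a ∷ u) v (c ∷ w) gb) ⟩
    Q₁ ℚ.+ (R₃ ℚ.+ Σш (a ∷ u) (b ∷ v) (λ x → Σш x w gc))
  ≡⟨ cong (λ z → Q₁ ℚ.+ (R₃ ℚ.+ z)) (Σш-assoc (a ∷ u) (b ∷ v) w gc) ⟩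
    Q₁ ℚ.+ (R₃ ℚ.+ R₄)
  ≡⟨ sym expand-right ⟩
    Σш (b ∷ v) (c ∷ w) (λ y → Σш (a ∷ u) y g)
  ∎
  where
  open ≡-Reasoning
  au = a ∷ u
  bv = b ∷ v
  cw = c ∷ w
  ga = g ∘ (a ∷_)
  gb = g ∘ (b ∷_)
  gc = g ∘ (c ∷_)
  P₁ = Σш u bv (λ x → Σш x cw ga)
  P₂ = Σш u bv (λ x → Σш (a ∷ x) w gc)
  P₃ = Σш au v (λ x → Σш x cw gb)
  P₄ = Σш au v (λ x → Σш (b ∷ x) w gc)
  R₁ = Σш v cw (λ y → Σш u (b ∷ y) ga)
  R₂ = Σш bv w (λ y → Σш u (c ∷ y) ga)
  R₃ = Σш v cw (λ y → Σш au y gb)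
  R₄ = Σш bv w (λ y → Σш au y gc)
  Q₁ = Σш bv cw (λ y → Σш u y ga)
  expand-right : Σш bv cw (λ y → Σш au y g) ≡ Q₁ ℚ.+ (R₃ ℚ.+ R₄)
  expand-right = begin
      Σш bv cw (λ y → Σш au y g)
    ≡⟨ Σш-∷-ext b v c w _ _ (λ y → Σш-∷ a u b y g) (λ y → Σш-∷ a u c y g) ⟩
      Σш v cw (λ y → Σш u (b ∷ y) ga ℚ.+ Σш au y gb) ℚ.+
      Σш bv w (λ y → Σш u (c ∷ y) ga ℚ.+ Σш au y gc)
    ≡⟨ cong₂ ℚ._+_ (Σш-+ v cw _ _) (Σш-+ bv w _ _) ⟩
      (R₁ ℚ.+ R₃) ℚ.+ (R₂ ℚ.+ R₄)
    ≡⟨ solve 4 (λ r₁ r₂ r₃ r₄ → (r₁ :+ r₃) :+ (r₂ :+ r₄) := (r₁ :+ r₂) :+ (r₃ :+ r₄)) refl R₁ R₂ R₃ R₄ ⟩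
      (R₁ ℚ.+ R₂) ℚ.+ (R₃ ℚ.+ R₄)
    ≡⟨ cong (ℚ._+ (R₃ ℚ.+ R₄)) (sym (Σш-∷ b v c w (λ y → Σш u y ga))) ⟩
      Q₁ ℚ.+ (R₃ ℚ.+ R₄)
    ∎

dec : Word → List (Word × Word)
dec [] = ([] , []) ∷ []
dec (a ∷ w) = ([] , a ∷ w) ∷ map (λ p → (a ∷ proj₁ p , proj₂ p)) (dec w)

dec-++ : ∀ w → All (λ p → proj₁ p ++ proj₂ p ≡ w) (dec w)
dec-++ [] = refl ∷ []
dec-++ (a ∷ w) = refl ∷ AllP.map⁺ (All.map (cong (a ∷_)) (dec-++ w))

opaque
  Σdec : Word → (Word × Word → ℚ) → ℚ
  Σdec w h = Σlist (dec w) h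

  Σdec-[] : ∀ h → Σdec [] h ≡ h ([] , [])
  Σdec-[] h = QP.+-identityʳ _

  Σdec-∷ : ∀ a w h → Σdec (a ∷ w) h ≡ h ([] , a ∷ w) ℚ.+ Σdec w (λ p → h (a ∷ proj₁ p , proj₂ p))
  Σdec-∷ a w h = cong (h ([] , a ∷ w) ℚ.+_) (Σlist-map _ (dec w) h)

  Σdec-ext : ∀ w {g h} → (∀ p → g p ≡ h p) → Σdec w g ≡ Σdec w h
  Σdec-ext w = Σlist-ext (dec w)

  Σdec-+ : ∀ w g h → Σdec w (λ p → g p ℚ.+ h p) ≡ Σdec w g ℚ.+ Σdec w h
  Σdec-+ w = Σlist-+ (dec w)

  Σdec-neg : ∀ w h → Σdec w (λ p → ℚ.- h p) ≡ ℚ.- Σdec w h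
  Σdec-neg w = Σlist-neg (dec w)

  Σdec-0 : ∀ w → Σdec w (λ _ → 0ℚ) ≡ 0ℚ
  Σdec-0 w = Σlist-0 (dec w)

  Σdec-pair-swap : ∀ w (x : Free B) (φ : Word × Word → B → ℚ) →
                   Σdec w (λ p → pair x (φ p)) ≡ pair x (λ c → Σdec w (λ p → φ p c))
  Σdec-pair-swap w = Σlist-pair-swap (dec w)

  pair-formalSum-dec : ∀ w h → pair (formalSum (dec w)) h ≡ Σdec w h
  pair-formalSum-dec w = pair-formalSum (dec w)

  Σdec-supp : ∀ w {g h : Word × Word → ℚ} → (∀ u v → u ++ v ≡ w → g (u , v) ≡ h (u , v)) → Σdec w g ≡ Σdec w h
  Σdec-supp w e = Σlist-supp (dec-++ w) (λ p → e (proj₁ p) (proj₂ p))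

Σdec-coassoc : ∀ w (Ψ : Word → Word → Word → ℚ) →
  Σdec w (λ p → Σdec (proj₁ p) (λ q → Ψ (proj₁ q) (proj₂ q) (proj₂ p))) ≡
  Σdec w (λ p → Σdec (proj₂ p) (λ q → Ψ (proj₁ p) (proj₁ q) (proj₂ q)))
Σdec-coassoc [] Ψ = trans (Σdec-[] _) (trans (Σdec-[] _) (sym (trans (Σdec-[] _) (Σdec-[] _))))
Σdec-coassoc (a ∷ w) Ψ = begin
    Σdec (a ∷ w) (λ p → Σdec (proj₁ p) (λ q → Ψ (proj₁ q) (proj₂ q) (proj₂ p)))
  ≡⟨ Σdec-∷ a w _ ⟩
    Σdec [] (λ q → Ψ (proj₁ q) (proj₂ q) (a ∷ w)) ℚ.+
    Σdec w (λ p → Σdec (a ∷ proj₁ p) (λ q → Ψ (proj₁ q) (proj₂ q) (proj₂ p)))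
  ≡⟨ cong₂ ℚ._+_ (Σdec-[] _) (trans (Σdec-ext w (λ p → Σdec-∷ a (proj₁ p) _)) (Σdec-+ w _ _)) ⟩
    Ψ [] [] (a ∷ w) ℚ.+ (N ℚ.+ Σdec w (λ p → Σdec (proj₁ p) (λ q → Ψ (a ∷ proj₁ q) (proj₂ q) (proj₂ p))))
  ≡⟨ cong (λ z → Ψ [] [] (a ∷ w) ℚ.+ (N ℚ.+ z)) (Σdec-coassoc w (λ x y z → Ψ (a ∷ x) y z)) ⟩
    Ψ [] [] (a ∷ w) ℚ.+ (N ℚ.+ M)
  ≡⟨ sym (QP.+-assoc (Ψ [] [] (a ∷ w)) N M) ⟩
    (Ψ [] [] (a ∷ w) ℚ.+ N) ℚ.+ M
  ≡⟨ cong (ℚ._+ M) (sym (Σdec-∷ a w (λ q → Ψ [] (proj₁ q) (proj₂ q)))) ⟩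
    Σdec (a ∷ w) (λ q → Ψ [] (proj₁ q) (proj₂ q)) ℚ.+ M
  ≡⟨ sym (Σdec-∷ a w _) ⟩
    Σdec (a ∷ w) (λ p → Σdec (proj₂ p) (λ q → Ψ (proj₁ p) (proj₁ q) (proj₂ q)))
  ∎
  where
  open ≡-Reasoning
  N = Σdec w (λ p → Ψ [] (a ∷ proj₁ p) (proj₂ p))
  M = Σdec w (λ p → Σdec (proj₂ p) (λ q → Ψ (a ∷ proj₁ p) (proj₁ q) (proj₂ q)))

Σdec-∷ʳ : ∀ w a k → Σdec (w ++ [ a ]) k ≡ Σdec w (λ p → k (proj₁ p , proj₂ p ++ [ a ])) ℚ.+ k (w ++ [ a ] , [])
Σdec-∷ʳ [] a k = begin
    Σdec [ a ] k                                 ≡⟨ Σdec-∷ a [] k ⟩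
    k ([] , [ a ]) ℚ.+ Σdec [] (λ p → k (a ∷ proj₁ p , proj₂ p))
      ≡⟨ cong₂ ℚ._+_ (sym (Σdec-[] (λ p → k (proj₁ p , proj₂ p ++ [ a ])))) (Σdec-[] _) ⟩
    Σdec [] (λ p → k (proj₁ p , proj₂ p ++ [ a ])) ℚ.+ k ([ a ] , []) ∎
  where open ≡-Reasoning
Σdec-∷ʳ (b ∷ w) a k = begin
    Σdec (b ∷ w ++ [ a ]) k
  ≡⟨ Σdec-∷ b (w ++ [ a ]) k ⟩
    k ([] , b ∷ w ++ [ a ]) ℚ.+ Σdec (w ++ [ a ]) (λ p → k (b ∷ proj₁ p , proj₂ p))
  ≡⟨ cong (k ([] , b ∷ w ++ [ a ]) ℚ.+_) (Σdec-∷ʳ w a (λ p → k (b ∷ proj₁ p , proj₂ p))) ⟩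
    k ([] , b ∷ w ++ [ a ]) ℚ.+ (Σdec w (λ p → k (b ∷ proj₁ p , proj₂ p ++ [ a ])) ℚ.+ k (b ∷ w ++ [ a ] , []))
  ≡⟨ sym (QP.+-assoc (k ([] , b ∷ w ++ [ a ])) _ _) ⟩
    (k ([] , b ∷ w ++ [ a ]) ℚ.+ Σdec w (λ p → k (b ∷ proj₁ p , proj₂ p ++ [ a ]))) ℚ.+ k (b ∷ w ++ [ a ] , [])
  ≡⟨ cong (ℚ._+ k (b ∷ w ++ [ a ] , [])) (sym (Σdec-∷ b w (λ p → k (proj₁ p , proj₂ p ++ [ a ])))) ⟩
    Σdec (b ∷ w) (λ p → k (proj₁ p , proj₂ p ++ [ a ])) ℚ.+ k (b ∷ w ++ [ a ] , [])
  ∎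
  where open ≡-Reasoning

Σdec-reverse : ∀ w k → Σdec w k ≡ Σdec (reverse w) (λ p → k (reverse (proj₂ p) , reverse (proj₁ p)))
Σdec-reverse [] k = trans (Σdec-[] k) (sym (Σdec-[] _))
Σdec-reverse (a ∷ w) k = begin
    Σdec (a ∷ w) k
  ≡⟨ Σdec-∷ a w k ⟩
    k ([] , a ∷ w) ℚ.+ Σdec w (λ p → k (a ∷ proj₁ p , proj₂ p))
  ≡⟨ cong (k ([] , a ∷ w) ℚ.+_) (Σdec-reverse w (λ p → k (a ∷ proj₁ p , proj₂ p))) ⟩
    k ([] , a ∷ w) ℚ.+ Σdec (reverse w) (λ p → k (a ∷ reverse (proj₂ p) , reverse (proj₁ p)))
  ≡⟨ QP.+-comm (k ([] , a ∷ w)) _ ⟩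
    Σdec (reverse w) (λ p → k (a ∷ reverse (proj₂ p) , reverse (proj₁ p))) ℚ.+ k ([] , a ∷ w)
  ≡⟨ cong₂ ℚ._+_ (Σdec-ext (reverse w) (λ p → cong (λ z → k (z , reverse (proj₁ p))) (sym (LP.reverse-++ (proj₂ p) [ a ]))))
                 (cong (λ z → k ([] , z)) (sym (trans (LP.reverse-++ (reverse w) [ a ]) (cong (a ∷_) (LP.reverse-involutive w))))) ⟩
    Σdec (reverse w) (λ p → k (reverse (proj₂ p ++ [ a ]) , reverse (proj₁ p))) ℚ.+ k ([] , reverse (reverse w ++ [ a ]))
  ≡⟨ sym (Σdec-∷ʳ (reverse w) a (λ p → k (reverse (proj₂ p) , reverse (proj₁ p)))) ⟩
    Σdec (reverse w ++ [ a ]) (λ p → k (reverse (proj₂ p) , reverse (proj₁ p)))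
  ≡⟨ cong (λ z → Σdec z (λ p → k (reverse (proj₂ p) , reverse (proj₁ p)))) (sym (LP.unfold-reverse a w)) ⟩
    Σdec (reverse (a ∷ w)) (λ p → k (reverse (proj₂ p) , reverse (proj₁ p)))
  ∎
  where open ≡-Reasoning

ε₀ : Word → ℚ
ε₀ [] = 1ℚ
ε₀ (_ ∷ _) = 0ℚ

Σdec-counitˡ : ∀ w (f : Word → ℚ) → Σdec w (λ p → ε₀ (proj₁ p) ℚ.* f (proj₂ p)) ≡ f w
Σdec-counitˡ [] f = trans (Σdec-[] _) (QP.*-identityˡ (f []))
Σdec-counitˡ (a ∷ w) f = begin
    Σdec (a ∷ w) (λ p → ε₀ (proj₁ p) ℚ.* f (proj₂ p))
  ≡⟨ Σdec-∷ a w _ ⟩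
    1ℚ ℚ.* f (a ∷ w) ℚ.+ Σdec w (λ p → 0ℚ ℚ.* f (proj₂ p))
  ≡⟨ cong₂ ℚ._+_ (QP.*-identityˡ (f (a ∷ w))) (trans (Σdec-ext w (λ p → QP.*-zeroˡ (f (proj₂ p)))) (Σdec-0 w)) ⟩
    f (a ∷ w) ℚ.+ 0ℚ
  ≡⟨ QP.+-identityʳ (f (a ∷ w)) ⟩
    f (a ∷ w)
  ∎
  where open ≡-Reasoning

Σdec-counitʳ : ∀ w (f : Word → ℚ) → Σdec w (λ p → ε₀ (proj₂ p) ℚ.* f (proj₁ p)) ≡ f w
Σdec-counitʳ [] f = trans (Σdec-[] _) (QP.*-identityˡ (f []))
Σdec-counitʳ (a ∷ w) f = begin
    Σdec (a ∷ w) (λ p → ε₀ (proj₂ p) ℚ.* f (proj₁ p))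
  ≡⟨ Σdec-∷ a w _ ⟩
    0ℚ ℚ.* f [] ℚ.+ Σdec w (λ p → ε₀ (proj₂ p) ℚ.* f (a ∷ proj₁ p))
  ≡⟨ cong₂ ℚ._+_ (QP.*-zeroˡ (f [])) (Σdec-counitʳ w (f ∘ (a ∷_))) ⟩
    0ℚ ℚ.+ f (a ∷ w)
  ≡⟨ QP.+-identityˡ (f (a ∷ w)) ⟩
    f (a ∷ w)
  ∎
  where open ≡-Reasoning

Σш⊗ : (Word × Word → ℚ) → Word × Word → Word × Word → ℚ
Σш⊗ h p r = Σш (proj₁ p) (proj₁ r) (λ x → Σш (proj₂ p) (proj₂ r) (λ y → h (x , y)))

first-∷ : Letter → (Word × Word → ℚ) → Word × Word → ℚ
first-∷ a h p = h (a ∷ proj₁ p , proj₂ p)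

-- the right-hand side of Σш-Σdec obeys the recursion Σш-∷
Σdec-Σш⊗-∷ : ∀ a u b v h →
  Σdec (a ∷ u) (λ p → Σdec (b ∷ v) (Σш⊗ h p)) ≡
  Σш (a ∷ u) (b ∷ v) (λ w → h ([] , w)) ℚ.+
    (Σdec u (λ p → Σdec (b ∷ v) (Σш⊗ (first-∷ a h) p)) ℚ.+ Σdec (a ∷ u) (λ p → Σdec v (Σш⊗ (first-∷ b h) p)))
Σdec-Σш⊗-∷ a u b v h = sym (begin
    C₀ ℚ.+ (Σdec u (λ p → Σdec (b ∷ v) (Σш⊗ ha p)) ℚ.+ Σdec (a ∷ u) (λ p → Σdec v (Σш⊗ hb p)))
  ≡⟨ cong₂ (λ z t → C₀ ℚ.+ (z ℚ.+ t)) (trans (Σdec-ext u (λ p → Σdec-∷ b v (Σш⊗ ha p))) (Σdec-+ u _ _)) (Σdec-∷ a u _) ⟩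
    C₀ ℚ.+ ((E₁ ℚ.+ E₂) ℚ.+ (F₁ ℚ.+ F₂))
  ≡⟨ solve 5 (λ c e₁ e₂ f₁ f₂ → c :+ ((e₁ :+ e₂) :+ (f₁ :+ f₂)) := (c :+ f₁) :+ (e₁ :+ (e₂ :+ f₂))) refl C₀ E₁ E₂ F₁ F₂ ⟩
    (C₀ ℚ.+ F₁) ℚ.+ (E₁ ℚ.+ (E₂ ℚ.+ F₂))
  ≡⟨ cong₂ (λ z t → (z ℚ.+ F₁) ℚ.+ (E₁ ℚ.+ t)) (sym (Σш-[]ˡ [] _)) (trans (sym (Σdec-+ u _ _))
       (Σdec-ext u (λ p → trans (sym (Σdec-+ v _ _)) (Σdec-ext v (λ r → sym (Σш-∷ a (proj₁ p) b (proj₁ r) _)))))) ⟩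
    (Σш⊗ h ([] , a ∷ u) ([] , b ∷ v) ℚ.+ F₁) ℚ.+ (E₁ ℚ.+ G₂)
  ≡⟨ cong₂ (λ z t → (Σш⊗ h ([] , a ∷ u) ([] , b ∷ v) ℚ.+ z) ℚ.+ t)
       (Σdec-ext v (λ r → trans (Σш-[]ˡ (proj₁ r) _) (sym (Σш-[]ˡ (b ∷ proj₁ r) _))))
       (trans (cong (ℚ._+ G₂) (Σdec-ext u (λ p → trans (Σш-[]ʳ (proj₁ p) _) (sym (Σш-[]ʳ (a ∷ proj₁ p) _)))))
              (trans (sym (Σdec-+ u _ _)) (Σdec-ext u (λ p → sym (Σdec-∷ b v _))))) ⟩
    (Σш⊗ h ([] , a ∷ u) ([] , b ∷ v) ℚ.+ Σdec v (λ r → Σш⊗ h ([] , a ∷ u) (b ∷ proj₁ r , proj₂ r))) ℚ.+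
      G
  ≡⟨ cong (ℚ._+ G) (sym (Σdec-∷ b v _)) ⟩
    Σdec (b ∷ v) (Σш⊗ h ([] , a ∷ u)) ℚ.+ G
  ≡⟨ sym (Σdec-∷ a u _) ⟩
    Σdec (a ∷ u) (λ p → Σdec (b ∷ v) (Σш⊗ h p))
  ∎)
  where
  open ≡-Reasoning
  ha = first-∷ a h
  hb = first-∷ b h
  C₀ = Σш (a ∷ u) (b ∷ v) (λ w → h ([] , w))
  E₁ = Σdec u (λ p → Σш⊗ ha p ([] , b ∷ v))
  E₂ = Σdec u (λ p → Σdec v (λ r → Σш⊗ ha p (b ∷ proj₁ r , proj₂ r)))
  F₁ = Σdec v (Σш⊗ hb ([] , a ∷ u))
  F₂ = Σdec u (λ p → Σdec v (Σш⊗ hb (a ∷ proj₁ p , proj₂ p)))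
  G₂ = Σdec u (λ p → Σdec v (λ r → Σш⊗ h (a ∷ proj₁ p , proj₂ p) (b ∷ proj₁ r , proj₂ r)))
  G = Σdec u (λ p → Σdec (b ∷ v) (Σш⊗ h (a ∷ proj₁ p , proj₂ p)))

Σш-Σdec : ∀ u v h → Σш u v (λ w → Σdec w h) ≡ Σdec u (λ p → Σdec v (Σш⊗ h p))
Σш-Σdec [] v h = begin
    Σш [] v (λ w → Σdec w h)                  ≡⟨ Σш-[]ˡ v _ ⟩
    Σdec v h                                  ≡⟨ Σdec-ext v (λ r → sym (trans (Σш-[]ˡ (proj₁ r) _) (Σш-[]ˡ (proj₂ r) _))) ⟩
    Σdec v (Σш⊗ h ([] , []))                  ≡⟨ sym (Σdec-[] _) ⟩
    Σdec [] (λ p → Σdec v (Σш⊗ h p))          ∎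
  where open ≡-Reasoning
Σш-Σdec (a ∷ u) [] h = begin
    Σш (a ∷ u) [] (λ w → Σdec w h)            ≡⟨ Σш-[]ʳ (a ∷ u) _ ⟩
    Σdec (a ∷ u) h                            ≡⟨ Σdec-ext (a ∷ u) (λ p → sym (trans (Σdec-[] _) (trans (Σш-[]ʳ (proj₁ p) _) (Σш-[]ʳ (proj₂ p) _)))) ⟩
    Σdec (a ∷ u) (λ p → Σdec [] (Σш⊗ h p))    ∎
  where open ≡-Reasoning
Σш-Σdec (a ∷ u) (b ∷ v) h = begin
    Σш (a ∷ u) (b ∷ v) (λ w → Σdec w h)
  ≡⟨ Σш-∷-ext a u b v _ _ (λ w → Σdec-∷ a w h) (λ w → Σdec-∷ b w h) ⟩
    Σш u (b ∷ v) (λ w → h ([] , a ∷ w) ℚ.+ Σdec w (first-∷ a h)) ℚ.+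
    Σш (a ∷ u) v (λ w → h ([] , b ∷ w) ℚ.+ Σdec w (first-∷ b h))
  ≡⟨ cong₂ ℚ._+_ (Σш-+ u (b ∷ v) _ _) (Σш-+ (a ∷ u) v _ _) ⟩
    (A₁ ℚ.+ A₂) ℚ.+ (B₁ ℚ.+ B₂)
  ≡⟨ solve 4 (λ a₁ a₂ b₁ b₂ → (a₁ :+ a₂) :+ (b₁ :+ b₂) := (a₁ :+ b₁) :+ (a₂ :+ b₂)) refl A₁ A₂ B₁ B₂ ⟩
    (A₁ ℚ.+ B₁) ℚ.+ (A₂ ℚ.+ B₂)
  ≡⟨ cong₂ ℚ._+_ (sym (Σш-∷ a u b v (λ w → h ([] , w))))
       (cong₂ ℚ._+_ (Σш-Σdec u (b ∷ v) (first-∷ a h)) (Σш-Σdec (a ∷ u) v (first-∷ b h))) ⟩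
    Σш (a ∷ u) (b ∷ v) (λ w → h ([] , w)) ℚ.+
      (Σdec u (λ p → Σdec (b ∷ v) (Σш⊗ (first-∷ a h) p)) ℚ.+ Σdec (a ∷ u) (λ p → Σdec v (Σш⊗ (first-∷ b h) p)))
  ≡⟨ sym (Σdec-Σш⊗-∷ a u b v h) ⟩
    Σdec (a ∷ u) (λ p → Σdec (b ∷ v) (Σш⊗ h p))
  ∎
  where
  open ≡-Reasoning
  A₁ = Σш u (b ∷ v) (λ w → h ([] , a ∷ w))
  A₂ = Σш u (b ∷ v) (λ w → Σdec w (first-∷ a h))
  B₁ = Σш (a ∷ u) v (λ w → h ([] , b ∷ w))
  B₂ = Σш (a ∷ u) v (λ w → Σdec w (first-∷ b h))

-- Regularisation

-- written as in Defs, so that they agree definitionally with bumps and (c)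
nat : ℕ → ℚ
nat n = (+ n) ℚ./ 1

inv : ℕ → ℚ
inv m = (+ 1) ℚ./ suc m

private
  coprime-1 : ∀ n → Coprime n 1
  coprime-1 n = Cop.sym (1-coprimeTo n)

  nat-mkℚ : ∀ n → nat n ≡ mkℚ (+ n) 0 (coprime-1 n)
  nat-mkℚ n = QP.normalize-coprime (coprime-1 n)

inv-nat : ∀ m → inv m ℚ.* nat (suc m) ≡ 1ℚ
inv-nat m rewrite QP.normalize-coprime {1} {m} (1-coprimeTo (suc m)) | nat-mkℚ (suc m) =
  QP.*-inverseˡ (mkℚ (+ suc m) 0 (coprime-1 (suc m)))

nat-suc : ∀ m → nat (suc m) ≡ 1ℚ ℚ.+ nat m
nat-suc m rewrite nat-mkℚ (suc m) | nat-mkℚ m = QP.toℚᵘ-injective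
  (UP.≃-trans (U.*≡* (ℤ-identity (+ 1) (+ m))) (UP.≃-sym (QP.toℚᵘ-homo-+ 1ℚ (mkℚ (+ m) 0 (coprime-1 m)))))
  where
  ℤ-identity : ∀ a b → (a ℤ.+ b) ℤ.* (a ℤ.* a) ≡ (a ℤ.* a ℤ.+ b ℤ.* a) ℤ.* a
  ℤ-identity = solve-∀

nat-1 : nat 1 ≡ 1ℚ
nat-1 = nat-mkℚ 1

x₀^ : ℕ → Word
x₀^ m = replicate m x₀

x₁x₀^ : ℕ → Word
x₁x₀^ m = x₁ ∷ x₀^ m

Σш-x₀-∷ : ∀ b w g → Σш [ x₀ ] (b ∷ w) g ≡ g (x₀ ∷ b ∷ w) ℚ.+ Σш [ x₀ ] w (g ∘ (b ∷_))
Σш-x₀-∷ b w g = trans (Σш-∷ x₀ [] b w g) (cong (ℚ._+ Σш [ x₀ ] w (g ∘ (b ∷_))) (Σш-[]ˡ (b ∷ w) (g ∘ (x₀ ∷_))))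

Σш-x₀-x₀^ : ∀ m g → Σш [ x₀ ] (x₀^ m) g ≡ nat (suc m) ℚ.* g (x₀^ (suc m))
Σш-x₀-x₀^ zero g = trans (Σш-[]ʳ [ x₀ ] g) (sym (trans (cong (ℚ._* g [ x₀ ]) nat-1) (QP.*-identityˡ _)))
Σш-x₀-x₀^ (suc m) g = begin
    Σш [ x₀ ] (x₀ ∷ x₀^ m) g                              ≡⟨ Σш-x₀-∷ x₀ (x₀^ m) g ⟩
    G ℚ.+ Σш [ x₀ ] (x₀^ m) (g ∘ (x₀ ∷_))                ≡⟨ cong (G ℚ.+_) (Σш-x₀-x₀^ m (g ∘ (x₀ ∷_))) ⟩
    G ℚ.+ nat (suc m) ℚ.* G                               ≡⟨ solve 2 (λ a n → a :+ n :* a := (con 1ℚ :+ n) :* a) refl G (nat (suc m)) ⟩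
    (1ℚ ℚ.+ nat (suc m)) ℚ.* G                            ≡⟨ cong (ℚ._* G) (sym (nat-suc (suc m))) ⟩
    nat (suc (suc m)) ℚ.* G                               ∎
  where
  open ≡-Reasoning
  G = g (x₀^ (suc (suc m)))

Σш-x₀-x₁x₀^ : ∀ c m g → Σш [ x₀ ] (c ++ x₁x₀^ m) g ≡
  Σш [ x₀ ] c (λ w → g (w ++ x₁x₀^ m)) ℚ.+ nat (suc m) ℚ.* g (c ++ x₁x₀^ (suc m))
Σш-x₀-x₁x₀^ [] m g = begin
    Σш [ x₀ ] (x₁ ∷ x₀^ m) g
  ≡⟨ Σш-x₀-∷ x₁ (x₀^ m) g ⟩
    g (x₀ ∷ x₁x₀^ m) ℚ.+ Σш [ x₀ ] (x₀^ m) (g ∘ (x₁ ∷_))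
  ≡⟨ cong₂ ℚ._+_ (sym (Σш-[]ʳ [ x₀ ] (λ w → g (w ++ x₁x₀^ m)))) (Σш-x₀-x₀^ m (g ∘ (x₁ ∷_))) ⟩
    Σш [ x₀ ] [] (λ w → g (w ++ x₁x₀^ m)) ℚ.+ nat (suc m) ℚ.* g (x₁x₀^ (suc m))
  ∎
  where open ≡-Reasoning
Σш-x₀-x₁x₀^ (b ∷ c) m g = begin
    Σш [ x₀ ] (b ∷ c ++ x₁x₀^ m) g
  ≡⟨ Σш-x₀-∷ b (c ++ x₁x₀^ m) g ⟩
    g (x₀ ∷ b ∷ c ++ x₁x₀^ m) ℚ.+ Σш [ x₀ ] (c ++ x₁x₀^ m) (g ∘ (b ∷_))
  ≡⟨ cong (g (x₀ ∷ b ∷ c ++ x₁x₀^ m) ℚ.+_) (Σш-x₀-x₁x₀^ c m (g ∘ (b ∷_))) ⟩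
    g (x₀ ∷ b ∷ c ++ x₁x₀^ m) ℚ.+ (Σш [ x₀ ] c (λ w → g (b ∷ w ++ x₁x₀^ m)) ℚ.+ N)
  ≡⟨ sym (QP.+-assoc (g (x₀ ∷ b ∷ c ++ x₁x₀^ m)) _ N) ⟩
    (g (x₀ ∷ b ∷ c ++ x₁x₀^ m) ℚ.+ Σш [ x₀ ] c (λ w → g (b ∷ w ++ x₁x₀^ m))) ℚ.+ N
  ≡⟨ cong (ℚ._+ N) (sym (Σш-x₀-∷ b c (λ w → g (w ++ x₁x₀^ m)))) ⟩
    Σш [ x₀ ] (b ∷ c) (λ w → g (w ++ x₁x₀^ m)) ℚ.+ N
  ∎
  where
  open ≡-Reasoning
  N = nat (suc m) ℚ.* g (b ∷ c ++ x₁x₀^ (suc m))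

data TailView : Word → Set where
  only-x₀ : ∀ m → TailView (x₀^ m)
  _·x₁x₀^_ : ∀ c m → TailView (c ++ x₁x₀^ m)

consView : ∀ a {w} → TailView w → TailView (a ∷ w)
consView x₀ (only-x₀ m) = only-x₀ (suc m)
consView x₀ (c ·x₁x₀^ m) = (x₀ ∷ c) ·x₁x₀^ m
consView x₁ (only-x₀ m) = [] ·x₁x₀^ m
consView x₁ (c ·x₁x₀^ m) = (x₁ ∷ c) ·x₁x₀^ m

tailView : ∀ w → TailView w
tailView [] = only-x₀ 0
tailView (a ∷ w) = consView a (tailView w)

tailView-x₀^ : ∀ m → tailView (x₀^ m) ≡ only-x₀ m
tailView-x₀^ zero = refl
tailView-x₀^ (suc m) rewrite tailView-x₀^ m = refl

tailView-x₁x₀^ : ∀ c m → tailView (c ++ x₁x₀^ m) ≡ c ·x₁x₀^ m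
tailView-x₁x₀^ [] m rewrite tailView-x₀^ m = refl
tailView-x₁x₀^ (x₀ ∷ c) m rewrite tailView-x₁x₀^ c m = refl
tailView-x₁x₀^ (x₁ ∷ c) m rewrite tailView-x₁x₀^ c m = refl

append-x₁ : Free Word → Free Word
append-x₁ = map (λ p → (proj₁ p , proj₂ p ++ [ x₁ ]))

-- reg is the projection onto the span of 𝟏 and the words ending in x₁
-- along the shuffle ideal x₀ ш ℚ⟨x₀,x₁⟩; unfolding regTail gives the
-- classical formula reg (c x₁ x₀^m) = (-1)^m (c ш x₀^m) x₁.
regTail : ℕ → Word → Free Word
regTail zero c = basis c
regTail (suc m) c = scale (ℚ.- inv m) (lin (regTail m) (formalSum (sh [ x₀ ] c)))

regOfView : ∀ {w} → TailView w → Free Word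
regOfView (only-x₀ zero) = basis []
regOfView (only-x₀ (suc _)) = []
regOfView (c ·x₁x₀^ m) = append-x₁ (regTail m c)

reg : Word → Free Word
reg w = regOfView (tailView w)

reg-x₁x₀^ : ∀ c m → reg (c ++ x₁x₀^ m) ≡ append-x₁ (regTail m c)
reg-x₁x₀^ c m rewrite tailView-x₁x₀^ c m = refl

pair-reg-x₁x₀^ : ∀ c m g → pair (reg (c ++ x₁x₀^ m)) g ≡ pair (regTail m c) (λ w → g (w ++ [ x₁ ]))
pair-reg-x₁x₀^ c m g = trans (cong (λ z → pair z g) (reg-x₁x₀^ c m)) (pair-map (_++ [ x₁ ]) (regTail m c) g)

pair-regTail-suc : ∀ m c g → pair (regTail (suc m) c) g ≡ ℚ.- inv m ℚ.* Σш [ x₀ ] c (λ w → pair (regTail m w) g)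
pair-regTail-suc m c g = begin
    pair (scale (ℚ.- inv m) (lin (regTail m) (formalSum (sh [ x₀ ] c)))) g
  ≡⟨ pair-scale (ℚ.- inv m) _ g ⟩
    ℚ.- inv m ℚ.* pair (lin (regTail m) (formalSum (sh [ x₀ ] c))) g
  ≡⟨ cong (ℚ.- inv m ℚ.*_) (trans (pair-lin (regTail m) _ g) (pair-formalSum-sh [ x₀ ] c _)) ⟩
    ℚ.- inv m ℚ.* Σш [ x₀ ] c (λ w → pair (regTail m w) g)
  ∎
  where open ≡-Reasoning

KillsX₀Ideal : (Word → ℚ) → Set
KillsX₀Ideal Φ = ∀ v → Σш [ x₀ ] v Φ ≡ 0ℚ

reg-kills-x₀ш : ∀ g → KillsX₀Ideal (λ w → pair (reg w) g)
reg-kills-x₀ш g a with tailView a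
... | only-x₀ m = begin
    Σш [ x₀ ] (x₀^ m) (λ w → pair (reg w) g)            ≡⟨ Σш-x₀-x₀^ m _ ⟩
    nat (suc m) ℚ.* pair (reg (x₀^ (suc m))) g           ≡⟨ cong (λ z → nat (suc m) ℚ.* pair (regOfView z) g) (tailView-x₀^ (suc m)) ⟩
    nat (suc m) ℚ.* pair [] g                            ≡⟨ cong (nat (suc m) ℚ.*_) (pair-[] g) ⟩
    nat (suc m) ℚ.* 0ℚ                                   ≡⟨ QP.*-zeroʳ (nat (suc m)) ⟩
    0ℚ                                                   ∎
  where open ≡-Reasoning
... | c ·x₁x₀^ m = begin
    Σш [ x₀ ] (c ++ x₁x₀^ m) (λ w → pair (reg w) g)
  ≡⟨ Σш-x₀-x₁x₀^ c m _ ⟩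
    Σш [ x₀ ] c (λ w → pair (reg (w ++ x₁x₀^ m)) g) ℚ.+ nat (suc m) ℚ.* pair (reg (c ++ x₁x₀^ (suc m))) g
  ≡⟨ cong₂ (λ z t → z ℚ.+ nat (suc m) ℚ.* t) (Σш-ext [ x₀ ] c (λ w → pair-reg-x₁x₀^ w m g))
       (trans (pair-reg-x₁x₀^ c (suc m) g) (pair-regTail-suc m c _)) ⟩
    S ℚ.+ nat (suc m) ℚ.* (ℚ.- inv m ℚ.* S)
  ≡⟨ solve 3 (λ s n i → s :+ n :* (:- i :* s) := s :- (i :* n) :* s) refl S (nat (suc m)) (inv m) ⟩
    S ℚ.- (inv m ℚ.* nat (suc m)) ℚ.* S
  ≡⟨ cong (λ z → S ℚ.- z ℚ.* S) (inv-nat m) ⟩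
    S ℚ.- 1ℚ ℚ.* S
  ≡⟨ trans (cong (λ z → S ℚ.- z) (QP.*-identityˡ S)) (QP.+-inverseʳ S) ⟩
    0ℚ
  ∎
  where
  open ≡-Reasoning
  S = Σш [ x₀ ] c (λ w → pair (regTail m w) (λ v → g (v ++ [ x₁ ])))

kills-x₀ш⇒pair-reg : ∀ {Φ} → KillsX₀Ideal Φ → ∀ u → pair (reg u) Φ ≡ Φ u
kills-x₀ш⇒pair-reg {Φ} kills u with tailView u
... | only-x₀ zero = pair-basis [] Φ
... | only-x₀ (suc m) = sym (begin
    Φ (x₀^ (suc m))                                       ≡⟨ sym (trans (cong (ℚ._* Φ (x₀^ (suc m))) (inv-nat m)) (QP.*-identityˡ _)) ⟩
    inv m ℚ.* nat (suc m) ℚ.* Φ (x₀^ (suc m))            ≡⟨ QP.*-assoc (inv m) _ _ ⟩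
    inv m ℚ.* (nat (suc m) ℚ.* Φ (x₀^ (suc m)))          ≡⟨ cong (inv m ℚ.*_) (sym (Σш-x₀-x₀^ m Φ)) ⟩
    inv m ℚ.* Σш [ x₀ ] (x₀^ m) Φ                         ≡⟨ cong (inv m ℚ.*_) (kills (x₀^ m)) ⟩
    inv m ℚ.* 0ℚ                                          ≡⟨ QP.*-zeroʳ (inv m) ⟩
    0ℚ                                                    ≡⟨ sym (pair-[] Φ) ⟩
    pair [] Φ                                             ∎)
  where open ≡-Reasoning
... | c ·x₁x₀^ m = trans (pair-map (_++ [ x₁ ]) (regTail m c) Φ) (regTail-fixes m c)
  where
  open ≡-Reasoning
  regTail-fixes : ∀ m c → pair (regTail m c) (λ w → Φ (w ++ [ x₁ ])) ≡ Φ (c ++ x₁x₀^ m)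
  regTail-fixes zero c = pair-basis c _
  regTail-fixes (suc m) c = begin
      pair (regTail (suc m) c) (λ w → Φ (w ++ [ x₁ ]))
    ≡⟨ pair-regTail-suc m c _ ⟩
      ℚ.- inv m ℚ.* Σш [ x₀ ] c (λ w → pair (regTail m w) (λ v → Φ (v ++ [ x₁ ])))
    ≡⟨ cong (λ z → ℚ.- inv m ℚ.* z) (Σш-ext [ x₀ ] c (λ w → regTail-fixes m w)) ⟩
      ℚ.- inv m ℚ.* S
    ≡⟨ solve 4 (λ i n s g → :- i :* s := i :* (n :* g) :- i :* (s :+ n :* g)) refl (inv m) (nat (suc m)) S G ⟩
      inv m ℚ.* (nat (suc m) ℚ.* G) ℚ.- inv m ℚ.* (S ℚ.+ nat (suc m) ℚ.* G)
    -- Φ kills x₀ ш c x₁ x₀^m = (x₀ ш c) x₁ x₀^m + (m + 1) c x₁ x₀^(m+1)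
    ≡⟨ cong (λ z → inv m ℚ.* (nat (suc m) ℚ.* G) ℚ.- inv m ℚ.* z) (trans (sym (Σш-x₀-x₁x₀^ c m Φ)) (kills _)) ⟩
      inv m ℚ.* (nat (suc m) ℚ.* G) ℚ.- inv m ℚ.* 0ℚ
    ≡⟨ solve 3 (λ i n g → i :* (n :* g) :- i :* con 0ℚ := (i :* n) :* g) refl (inv m) (nat (suc m)) G ⟩
      inv m ℚ.* nat (suc m) ℚ.* G
    ≡⟨ trans (cong (ℚ._* G) (inv-nat m)) (QP.*-identityˡ G) ⟩
      G
    ∎
    where
    S = Σш [ x₀ ] c (λ w → Φ (w ++ x₁x₀^ m))
    G = Φ (c ++ x₁x₀^ (suc m))

-- the image of ρ: the empty word and the words ending in x₁
data Regular : Word → Set where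
  []ᴿ : Regular []
  [x₁]ᴿ : Regular [ x₁ ]
  _∷ᴿ_ : ∀ a {b w} → Regular (b ∷ w) → Regular (a ∷ b ∷ w)

regular-tail : ∀ {a w} → Regular (a ∷ w) → Regular w
regular-tail [x₁]ᴿ = []ᴿ
regular-tail (a ∷ᴿ r) = r

regular-suffix : ∀ u v → Regular (u ++ v) → Regular v
regular-suffix [] v r = r
regular-suffix (a ∷ u) v r = regular-suffix u v (regular-tail r)

regular-∷ : ∀ a {w} → Regular w → 0 ℕ.< length w → Regular (a ∷ w)
regular-∷ a {b ∷ w} r _ = a ∷ᴿ r

regular-x₁∷ : ∀ {w} → Regular w → Regular (x₁ ∷ w)
regular-x₁∷ []ᴿ = [x₁]ᴿ
regular-x₁∷ [x₁]ᴿ = x₁ ∷ᴿ [x₁]ᴿ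
regular-x₁∷ (a ∷ᴿ r) = x₁ ∷ᴿ (a ∷ᴿ r)

regular-∷ʳx₁ : ∀ c → Regular (c ++ [ x₁ ])
regular-∷ʳx₁ [] = [x₁]ᴿ
regular-∷ʳx₁ (a ∷ []) = a ∷ᴿ [x₁]ᴿ
regular-∷ʳx₁ (a ∷ b ∷ c) = a ∷ᴿ regular-∷ʳx₁ (b ∷ c)

regular-view : ∀ {w} → Regular w → (w ≡ []) ⊎ (Σ Word λ c → w ≡ c ++ [ x₁ ])
regular-view []ᴿ = inj₁ refl
regular-view [x₁]ᴿ = inj₂ ([] , refl)
regular-view (a ∷ᴿ r) with regular-view r
... | inj₂ (c , e) = inj₂ (a ∷ c , cong (a ∷_) e)

#x₁ : Word → ℕ
#x₁ [] = 0
#x₁ (x₀ ∷ w) = #x₁ w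
#x₁ (x₁ ∷ w) = suc (#x₁ w)

#x₁-++ : ∀ u v → #x₁ (u ++ v) ≡ #x₁ u + #x₁ v
#x₁-++ [] v = refl
#x₁-++ (x₀ ∷ u) v = #x₁-++ u v
#x₁-++ (x₁ ∷ u) v = cong suc (#x₁-++ u v)

#x₁-x₀^ : ∀ m → #x₁ (x₀^ m) ≡ 0
#x₁-x₀^ zero = refl
#x₁-x₀^ (suc m) = #x₁-x₀^ m

regular-#x₁ : ∀ {a w} → Regular (a ∷ w) → 0 ℕ.< #x₁ (a ∷ w)
regular-#x₁ [x₁]ᴿ = ℕ.s≤s ℕ.z≤n
regular-#x₁ (x₀ ∷ᴿ r) = regular-#x₁ r
regular-#x₁ (x₁ ∷ᴿ r) = ℕ.s≤s ℕ.z≤n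

Additive : Word → Word → Word → Set
Additive u v w = (length w ≡ length u + length v) × (#x₁ w ≡ #x₁ u + #x₁ v)

sh-additive : ∀ u v → All (Additive u v) (sh u v)
sh-additive [] v = (refl , refl) ∷ []
sh-additive (a ∷ u) [] = (sym (cong suc (NP.+-identityʳ (length u))) , sym (NP.+-identityʳ (#x₁ (a ∷ u)))) ∷ []
sh-additive (a ∷ u) (b ∷ v) =
  AllP.++⁺ (AllP.map⁺ (All.map left (sh-additive u (b ∷ v)))) (AllP.map⁺ (All.map right (sh-additive (a ∷ u) v)))
  where
  left : ∀ {w} → Additive u (b ∷ v) w → Additive (a ∷ u) (b ∷ v) (a ∷ w)
  left (l , k) = cong suc l , count a k
    where
    count : ∀ a → _ → #x₁ (a ∷ _) ≡ #x₁ (a ∷ u) + #x₁ (b ∷ v)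
    count x₀ k = k
    count x₁ k = cong suc k
  right : ∀ {w} → Additive (a ∷ u) v w → Additive (a ∷ u) (b ∷ v) (b ∷ w)
  right (l , k) = trans (cong suc l) (sym (NP.+-suc (suc (length u)) (length v))) , count b k
    where
    count : ∀ b → _ → #x₁ (b ∷ _) ≡ #x₁ (a ∷ u) + #x₁ (b ∷ v)
    count x₀ k = k
    count x₁ k = trans (cong suc k) (sym (NP.+-suc (#x₁ (a ∷ u)) (#x₁ v)))

sh-regular : ∀ {u v} → Regular u → Regular v → All Regular (sh u v)
sh-regular {[]} ru rv = rv ∷ []
sh-regular {a ∷ u} {[]} ru rv = ru ∷ []
sh-regular {a ∷ u} {b ∷ v} ru rv =
  AllP.++⁺ (AllP.map⁺ (All.zipWith left (sh-regular (regular-tail ru) rv , sh-additive u (b ∷ v))))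
           (AllP.map⁺ (All.zipWith right (sh-regular ru (regular-tail rv) , sh-additive (a ∷ u) v)))
  where
  nonempty : ∀ {w : Word} {n} → length w ≡ suc n → 0 ℕ.< length w
  nonempty e rewrite e = ℕ.s≤s ℕ.z≤n
  left : ∀ {w} → Regular w × Additive u (b ∷ v) w → Regular (a ∷ w)
  left {w} (r , l , _) = regular-∷ a r (nonempty {w} (trans l (NP.+-suc (length u) (length v))))
  right : ∀ {w} → Regular w × Additive (a ∷ u) v w → Regular (b ∷ w)
  right {w} (r , l , _) = regular-∷ b r (nonempty {w} l)

RegTerm : Word → Word → Set
RegTerm a w = Regular w × (length w ≡ length a) × (#x₁ w ≡ #x₁ a)

regTail-supp : ∀ m c → Supported (λ w → (length w ≡ m + length c) × (#x₁ w ≡ #x₁ c)) (regTail m c)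
regTail-supp zero c = (refl , refl) ∷ []
regTail-supp (suc m) c = AllP.map⁺ (supp-lin (regTail m) (AllP.map⁺ (sh-additive [ x₀ ] c)) step)
  where
  step : ∀ w → Additive [ x₀ ] c w → Supported _ (regTail m w)
  step w (l , k) = All.map (λ { (l' , k') → trans l' (trans (cong (m ℕ.+_) l) (NP.+-suc m (length c))) , trans k' k })
                           (regTail-supp m w)

reg-supp : ∀ a → Supported (RegTerm a) (reg a)
reg-supp a with tailView a
... | only-x₀ zero = ([]ᴿ , refl , refl) ∷ []
... | only-x₀ (suc m) = []
... | c ·x₁x₀^ m = AllP.map⁺ (All.map term (regTail-supp m c))
  where
  term : ∀ {w} → (length w ≡ m + length c) × (#x₁ w ≡ #x₁ c) → RegTerm (c ++ x₁x₀^ m) (w ++ [ x₁ ])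
  term {w} (l , k) = regular-∷ʳx₁ w , len , count
    where
    len : length (w ++ [ x₁ ]) ≡ length (c ++ x₁x₀^ m)
    len = begin
      length (w ++ [ x₁ ])       ≡⟨ LP.length-++ w ⟩
      length w + 1               ≡⟨ cong (_+ 1) l ⟩
      m + length c + 1           ≡⟨ +1≡suc-swap m (length c) ⟩
      length c + suc m           ≡⟨ cong (λ z → length c + suc z) (sym (LP.length-replicate m)) ⟩
      length c + length (x₁x₀^ m) ≡⟨ sym (LP.length-++ c) ⟩
      length (c ++ x₁x₀^ m)      ∎
      where
      open ≡-Reasoning
      +1≡suc-swap : ∀ m n → m + n + 1 ≡ n + suc m
      +1≡suc-swap m n = trans (NP.+-comm (m + n) 1) (trans (cong suc (NP.+-comm m n)) (sym (NP.+-suc n m)))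
    count : #x₁ (w ++ [ x₁ ]) ≡ #x₁ (c ++ x₁x₀^ m)
    count = trans (#x₁-++ w [ x₁ ]) (trans (cong (_+ 1) k) (sym (trans (#x₁-++ c (x₁x₀^ m)) (cong (λ z → #x₁ c + suc z) (#x₁-x₀^ m)))))

reg-regular : ∀ {w} → Regular w → reg w ≡ basis w
reg-regular r with regular-view r
... | inj₁ refl = refl
... | inj₂ (c , refl) = reg-x₁x₀^ c 0

pair-reg-regular : ∀ {w} → Regular w → (g : Word → ℚ) → pair (reg w) g ≡ g w
pair-reg-regular r g = trans (cong (λ z → pair z g) (reg-regular r)) (pair-basis _ g)

reg-Σш : ∀ a b g → Σш a b (λ w → pair (reg w) g) ≡ pair (reg a) (λ u → pair (reg b) (λ v → Σш u v g))
reg-Σш a b g = begin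
    Σш a b G                                          ≡⟨ sym (kills-x₀ш⇒pair-reg (kills-right b) a) ⟩
    pair (reg a) (λ u → Σш u b G)                     ≡⟨ pair-ext (reg a) (λ u → trans (Σш-comm u b G)
                                                           (trans (sym (kills-x₀ш⇒pair-reg (kills-right u) b))
                                                                  (pair-ext (reg b) (λ v → Σш-comm v u G)))) ⟩
    pair (reg a) (λ u → pair (reg b) (λ v → Σш u v G))
      ≡⟨ pair-supp (reg-supp a) (λ u ru → pair-supp (reg-supp b) (λ v rv →
           Σш-supp u v (sh-regular (proj₁ ru) (proj₁ rv)) (λ w rw → pair-reg-regular rw g))) ⟩
    pair (reg a) (λ u → pair (reg b) (λ v → Σш u v g)) ∎
  where
  open ≡-Reasoning
  G : Word → ℚ
  G w = pair (reg w) g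
  kills-right : ∀ c → KillsX₀Ideal (λ x → Σш x c G)
  kills-right c v = trans (Σш-assoc [ x₀ ] v c G) (trans (Σш-ext v c (reg-kills-x₀ш g)) (Σш-0 v c))

-- The derivations δᵢ on words

-- θ n w inserts one x₀, in all possible ways, in front of a letter of the
-- shortest prefix of w containing n letters x₁ (anywhere in w, the end
-- included, if w has fewer than n letters x₁); on ρ s it is δₙ s (θ-ρ).
θ : ℕ → Word → Free Word
θ zero w = []
θ (suc n) [] = basis [ x₀ ]
θ (suc n) (x₀ ∷ w) = basis (x₀ ∷ x₀ ∷ w) ⊕ map (λ p → (proj₁ p , x₀ ∷ proj₂ p)) (θ (suc n) w)
θ (suc n) (x₁ ∷ w) = basis (x₀ ∷ x₁ ∷ w) ⊕ map (λ p → (proj₁ p , x₁ ∷ proj₂ p)) (θ n w)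

next : Letter → ℕ → ℕ
next x₀ n = suc n
next x₁ n = n

pair-θ-0 : ∀ w g → pair (θ 0 w) g ≡ 0ℚ
pair-θ-0 w g = pair-[] g

pair-θ-[] : ∀ n g → pair (θ (suc n) []) g ≡ g [ x₀ ]
pair-θ-[] n g = pair-basis [ x₀ ] g

pair-θ-∷ : ∀ a n w g → pair (θ (suc n) (a ∷ w)) g ≡ g (x₀ ∷ a ∷ w) ℚ.+ pair (θ (next a n) w) (g ∘ (a ∷_))
pair-θ-∷ x₀ n w g = trans (pair-++ (basis (x₀ ∷ x₀ ∷ w)) _ g) (cong₂ ℚ._+_ (pair-basis _ g) (pair-map (x₀ ∷_) (θ (suc n) w) g))
pair-θ-∷ x₁ n w g = trans (pair-++ (basis (x₀ ∷ x₁ ∷ w)) _ g) (cong₂ ℚ._+_ (pair-basis _ g) (pair-map (x₁ ∷_) (θ n w) g))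

θ-beyond-#x₁ : ∀ n w g → #x₁ w ℕ.< n → pair (θ n w) g ≡ Σш [ x₀ ] w g
θ-beyond-#x₁ (suc n) [] g lt = trans (pair-θ-[] n g) (sym (Σш-[]ʳ [ x₀ ] g))
θ-beyond-#x₁ (suc n) (x₀ ∷ w) g lt =
  trans (pair-θ-∷ x₀ n w g) (trans (cong (g (x₀ ∷ x₀ ∷ w) ℚ.+_) (θ-beyond-#x₁ (suc n) w (g ∘ (x₀ ∷_)) lt)) (sym (Σш-x₀-∷ x₀ w g)))
θ-beyond-#x₁ (suc n) (x₁ ∷ w) g (ℕ.s≤s lt) =
  trans (pair-θ-∷ x₁ n w g) (trans (cong (g (x₀ ∷ x₁ ∷ w) ℚ.+_) (θ-beyond-#x₁ n w (g ∘ (x₁ ∷_)) lt)) (sym (Σш-x₀-∷ x₁ w g)))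

θ-Σш-x₀ : ∀ n w g → Σш [ x₀ ] w (λ y → pair (θ n y) g) ≡ pair (θ n w) (λ y → Σш [ x₀ ] y g)
θ-Σш-x₀ zero w g = trans (Σш-ext [ x₀ ] w (λ y → pair-θ-0 y g)) (trans (Σш-0 [ x₀ ] w) (sym (pair-θ-0 w _)))
θ-Σш-x₀ (suc n) [] g = begin
    Σш [ x₀ ] [] (λ y → pair (θ (suc n) y) g)
  ≡⟨ Σш-[]ʳ [ x₀ ] _ ⟩
    pair (θ (suc n) [ x₀ ]) g
  ≡⟨ pair-θ-∷ x₀ n [] g ⟩
    g (x₀ ∷ [ x₀ ]) ℚ.+ pair (θ (suc n) []) (g ∘ (x₀ ∷_))
  ≡⟨ cong (g (x₀ ∷ [ x₀ ]) ℚ.+_) (trans (pair-θ-[] n (g ∘ (x₀ ∷_))) (sym (Σш-[]ʳ [ x₀ ] (g ∘ (x₀ ∷_))))) ⟩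
    g (x₀ ∷ [ x₀ ]) ℚ.+ Σш [ x₀ ] [] (g ∘ (x₀ ∷_))
  ≡⟨ sym (Σш-x₀-∷ x₀ [] g) ⟩
    Σш [ x₀ ] [ x₀ ] g
  ≡⟨ sym (pair-θ-[] n (λ y → Σш [ x₀ ] y g)) ⟩
    pair (θ (suc n) []) (λ y → Σш [ x₀ ] y g)
  ∎
  where open ≡-Reasoning
θ-Σш-x₀ (suc n) (a ∷ w) g = begin
    Σш [ x₀ ] (a ∷ w) Φ
  ≡⟨ Σш-x₀-∷ a w Φ ⟩
    Φ (x₀ ∷ a ∷ w) ℚ.+ Σш [ x₀ ] w (Φ ∘ (a ∷_))
  ≡⟨ cong₂ ℚ._+_ (trans (pair-θ-∷ x₀ n (a ∷ w) g) (cong (g (x₀ ∷ x₀ ∷ a ∷ w) ℚ.+_) (pair-θ-∷ a n w (g ∘ (x₀ ∷_)))))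
                 (trans (Σш-ext [ x₀ ] w (λ y → pair-θ-∷ a n y g)) (Σш-+ [ x₀ ] w _ _)) ⟩
    (T₁ ℚ.+ (T₁ ℚ.+ T₂)) ℚ.+ (T₃ ℚ.+ Σш [ x₀ ] w (λ y → pair (θ (next a n) y) (g ∘ (a ∷_))))
  ≡⟨ cong (λ z → (T₁ ℚ.+ (T₁ ℚ.+ T₂)) ℚ.+ (T₃ ℚ.+ z)) (θ-Σш-x₀ (next a n) w (g ∘ (a ∷_))) ⟩
    (T₁ ℚ.+ (T₁ ℚ.+ T₂)) ℚ.+ (T₃ ℚ.+ T₄)
  ≡⟨ solve 4 (λ t₁ t₂ t₃ t₄ → (t₁ :+ (t₁ :+ t₂)) :+ (t₃ :+ t₄) := (t₁ :+ (t₁ :+ t₃)) :+ (t₂ :+ t₄)) refl T₁ T₂ T₃ T₄ ⟩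
    (T₁ ℚ.+ (T₁ ℚ.+ T₃)) ℚ.+ (T₂ ℚ.+ T₄)
  ≡⟨ cong₂ ℚ._+_ (sym (trans (Σш-x₀-∷ x₀ (a ∷ w) g) (cong (T₁ ℚ.+_) (Σш-x₀-∷ a w (g ∘ (x₀ ∷_))))))
                 (sym (trans (pair-ext (θ (next a n) w) (λ y → Σш-x₀-∷ a y g)) (pair-+ (θ (next a n) w) _ _))) ⟩
    Ψ (x₀ ∷ a ∷ w) ℚ.+ pair (θ (next a n) w) (Ψ ∘ (a ∷_))
  ≡⟨ sym (pair-θ-∷ a n w Ψ) ⟩
    pair (θ (suc n) (a ∷ w)) Ψ
  ∎
  where
  open ≡-Reasoning
  Φ = λ y → pair (θ (suc n) y) g
  Ψ = λ y → Σш [ x₀ ] y g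
  T₁ = g (x₀ ∷ x₀ ∷ a ∷ w)
  T₂ = pair (θ (next a n) w) (λ y → g (x₀ ∷ a ∷ y))
  T₃ = Σш [ x₀ ] w (λ y → g (x₀ ∷ a ∷ y))
  T₄ = pair (θ (next a n) w) (λ y → Σш [ x₀ ] y (g ∘ (a ∷_)))

θ⊗ : ℕ → (Word × Word → ℚ) → Word × Word → ℚ
θ⊗ n k p = pair (θ n (proj₁ p)) (λ u' → k (u' , proj₂ p)) ℚ.+ pair (θ (n ∸ #x₁ (proj₁ p)) (proj₂ p)) (λ v' → k (proj₁ p , v'))

next-∸ : ∀ a n u → suc n ∸ #x₁ (a ∷ u) ≡ next a n ∸ #x₁ u
next-∸ x₀ n u = refl
next-∸ x₁ n u = refl

θ-coderivation : ∀ n w k → pair (θ n w) (λ y → Σdec y k) ≡ Σdec w (θ⊗ n k)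
θ-coderivation zero w k = trans (pair-θ-0 w _) (sym (trans (Σdec-ext w vanish) (Σdec-0 w)))
  where
  vanish : ∀ p → θ⊗ 0 k p ≡ 0ℚ
  vanish (u , v) rewrite NP.0∸n≡0 (#x₁ u) = trans (cong₂ ℚ._+_ (pair-θ-0 u _) (pair-θ-0 v _)) (QP.+-identityˡ 0ℚ)
θ-coderivation (suc n) [] k = begin
    pair (θ (suc n) []) (λ y → Σdec y k)
  ≡⟨ pair-θ-[] n _ ⟩
    Σdec [ x₀ ] k
  ≡⟨ Σdec-∷ x₀ [] k ⟩
    k ([] , [ x₀ ]) ℚ.+ Σdec [] (λ p → k (x₀ ∷ proj₁ p , proj₂ p))
  ≡⟨ cong (k ([] , [ x₀ ]) ℚ.+_) (Σdec-[] _) ⟩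
    k ([] , [ x₀ ]) ℚ.+ k ([ x₀ ] , [])
  ≡⟨ QP.+-comm (k ([] , [ x₀ ])) (k ([ x₀ ] , [])) ⟩
    k ([ x₀ ] , []) ℚ.+ k ([] , [ x₀ ])
  ≡⟨ sym (cong₂ ℚ._+_ (pair-θ-[] n (λ u' → k (u' , []))) (pair-θ-[] n (λ v' → k ([] , v')))) ⟩
    θ⊗ (suc n) k ([] , [])
  ≡⟨ sym (Σdec-[] _) ⟩
    Σdec [] (θ⊗ (suc n) k)
  ∎
  where open ≡-Reasoning
θ-coderivation (suc n) (a ∷ w) k = begin
    pair (θ (suc n) (a ∷ w)) (λ y → Σdec y k)
  ≡⟨ pair-θ-∷ a n w _ ⟩
    Σdec (x₀ ∷ a ∷ w) k ℚ.+ pair (θ (next a n) w) (λ y → Σdec (a ∷ y) k)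
  ≡⟨ cong₂ ℚ._+_ (trans (Σdec-∷ x₀ (a ∷ w) k) (cong (k ([] , x₀ ∷ a ∷ w) ℚ.+_) (Σdec-∷ a w _)))
                 (trans (pair-ext (θ (next a n) w) (λ y → Σdec-∷ a y k)) (pair-+ (θ (next a n) w) _ _)) ⟩
    (k ([] , x₀ ∷ a ∷ w) ℚ.+ (k ([ x₀ ] , a ∷ w) ℚ.+ Z₁)) ℚ.+ (Z₂ ℚ.+ pair (θ (next a n) w) (λ y → Σdec y ka))
  ≡⟨ cong (λ z → (k ([] , x₀ ∷ a ∷ w) ℚ.+ (k ([ x₀ ] , a ∷ w) ℚ.+ Z₁)) ℚ.+ (Z₂ ℚ.+ z)) (θ-coderivation (next a n) w ka) ⟩
    (k ([] , x₀ ∷ a ∷ w) ℚ.+ (k ([ x₀ ] , a ∷ w) ℚ.+ Z₁)) ℚ.+ (Z₂ ℚ.+ Σdec w (θ⊗ (next a n) ka))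
  ≡⟨ solve 5 (λ p q z1 z2 d → (p :+ (q :+ z1)) :+ (z2 :+ d) := (q :+ (p :+ z2)) :+ (z1 :+ d)) refl
       (k ([] , x₀ ∷ a ∷ w)) (k ([ x₀ ] , a ∷ w)) Z₁ Z₂ (Σdec w (θ⊗ (next a n) ka)) ⟩
    (k ([ x₀ ] , a ∷ w) ℚ.+ (k ([] , x₀ ∷ a ∷ w) ℚ.+ Z₂)) ℚ.+ (Z₁ ℚ.+ Σdec w (θ⊗ (next a n) ka))
  ≡⟨ cong₂ ℚ._+_ (sym (cong₂ ℚ._+_ (pair-θ-[] n (λ u' → k (u' , a ∷ w))) (pair-θ-∷ a n w (λ v' → k ([] , v')))))
                 (sym (trans (Σdec-ext w θ⊗-∷) (Σdec-+ w _ _))) ⟩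
    θ⊗ (suc n) k ([] , a ∷ w) ℚ.+ Σdec w (λ p → θ⊗ (suc n) k (a ∷ proj₁ p , proj₂ p))
  ≡⟨ sym (Σdec-∷ a w _) ⟩
    Σdec (a ∷ w) (θ⊗ (suc n) k)
  ∎
  where
  open ≡-Reasoning
  ka = λ (p : Word × Word) → k (a ∷ proj₁ p , proj₂ p)
  Z₁ = Σdec w (λ p → k (x₀ ∷ a ∷ proj₁ p , proj₂ p))
  Z₂ = pair (θ (next a n) w) (λ y → k ([] , a ∷ y))
  θ⊗-∷ : ∀ p → θ⊗ (suc n) k (a ∷ proj₁ p , proj₂ p) ≡ k (x₀ ∷ a ∷ proj₁ p , proj₂ p) ℚ.+ θ⊗ (next a n) ka p
  θ⊗-∷ p = trans (cong₂ ℚ._+_ (pair-θ-∷ a n (proj₁ p) (λ u' → k (u' , proj₂ p)))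
                              (cong (λ z → pair (θ z (proj₂ p)) (λ v' → k (a ∷ proj₁ p , v'))) (next-∸ a n (proj₁ p))))
                  (QP.+-assoc (k (x₀ ∷ a ∷ proj₁ p , proj₂ p)) _ _)

Δᵣᵣ : (Word × Word → ℚ) → Word → ℚ
Δᵣᵣ Φ a = Σdec a (λ p → pair (reg (proj₁ p)) (λ a₁ → pair (reg (proj₂ p)) (λ a₂ → Φ (a₁ , a₂))))

Δᵣᵣ-kills-x₀ш : ∀ Φ → KillsX₀Ideal (Δᵣᵣ Φ)
Δᵣᵣ-kills-x₀ш Φ v = begin
    Σш [ x₀ ] v (λ w → Σdec w k)                          ≡⟨ Σш-Σdec [ x₀ ] v k ⟩
    Σdec [ x₀ ] F                                         ≡⟨ Σdec-∷ x₀ [] F ⟩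
    F ([] , [ x₀ ]) ℚ.+ Σdec [] (λ p → F (x₀ ∷ proj₁ p , proj₂ p)) ≡⟨ cong (F ([] , [ x₀ ]) ℚ.+_) (Σdec-[] _) ⟩
    F ([] , [ x₀ ]) ℚ.+ F ([ x₀ ] , [])                  ≡⟨ cong₂ ℚ._+_ (trans (Σdec-ext v right) (Σdec-0 v))
                                                                          (trans (Σdec-ext v left) (Σdec-0 v)) ⟩
    0ℚ ℚ.+ 0ℚ                                             ≡⟨ QP.+-identityˡ 0ℚ ⟩
    0ℚ                                                    ∎
  where
  open ≡-Reasoning
  k = λ (p : Word × Word) → pair (reg (proj₁ p)) (λ a₁ → pair (reg (proj₂ p)) (λ a₂ → Φ (a₁ , a₂)))
  F = λ (p : Word × Word) → Σdec v (Σш⊗ k p)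
  right : ∀ r → Σш⊗ k ([] , [ x₀ ]) r ≡ 0ℚ
  right r = trans (Σш-[]ˡ (proj₁ r) _) (trans (Σш-pair-swap [ x₀ ] (proj₂ r) (reg (proj₁ r)) _)
              (trans (pair-ext (reg (proj₁ r)) (λ a₁ → reg-kills-x₀ш (λ a₂ → Φ (a₁ , a₂)) (proj₂ r))) (pair-0 (reg (proj₁ r)))))
  left : ∀ r → Σш⊗ k ([ x₀ ] , []) r ≡ 0ℚ
  left r = trans (Σш-ext [ x₀ ] (proj₁ r) (λ x → Σш-[]ˡ (proj₂ r) _)) (reg-kills-x₀ш _ (proj₁ r))

θ-reg : ∀ n u g → pair (θ n u) (λ y → pair (reg y) g) ≡ pair (reg u) (λ a → pair (θ n a) (λ y → pair (reg y) g))
θ-reg n u g = sym (kills-x₀ш⇒pair-reg kills u)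
  where
  kills : KillsX₀Ideal (λ a → pair (θ n a) (λ y → pair (reg y) g))
  kills v = trans (θ-Σш-x₀ n v _) (trans (pair-ext (θ n v) (reg-kills-x₀ш g)) (pair-0 (θ n v)))

-- ΣΔ w H is H evaluated on Σ_{w = u v} reg u ⊗ v. Only the left factor
-- needs regularising: for regular w every suffix v is regular (ΣΔ≡Δᵣᵣ).
ΣΔ : Word → (Word × Word → ℚ) → ℚ
ΣΔ w H = Σdec w (λ p → pair (reg (proj₁ p)) (λ a → H (a , proj₂ p)))

ΣΔ≡Δᵣᵣ : ∀ {y} → Regular y → ∀ H → ΣΔ y H ≡ Δᵣᵣ H y
ΣΔ≡Δᵣᵣ {y} ry H = Σdec-supp y (λ u v e → pair-ext (reg u) (λ a₁ →
  sym (pair-reg-regular (regular-suffix u v (subst Regular (sym e) ry)) (λ a₂ → H (a₁ , a₂)))))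

pair-reg-ΣΔ : ∀ z H → pair (reg z) (λ y → ΣΔ y H) ≡ Δᵣᵣ H z
pair-reg-ΣΔ z H = trans (pair-supp (reg-supp z) (λ y ry → ΣΔ≡Δᵣᵣ (proj₁ ry) H)) (kills-x₀ш⇒pair-reg (Δᵣᵣ-kills-x₀ш H) z)

ΣΔ-supp : ∀ {w} → Regular w → ∀ {F F' : Word × Word → ℚ} →
          (∀ x y → Regular x → Regular y → F (x , y) ≡ F' (x , y)) → ΣΔ w F ≡ ΣΔ w F'
ΣΔ-supp {w} rw e = Σdec-supp w (λ u v eq →
  pair-supp (reg-supp u) (λ a ra → e a v (proj₁ ra) (regular-suffix u v (subst Regular (sym eq) rw))))

ΣΔ-ext : ∀ w {F F' : Word × Word → ℚ} → (∀ p → F p ≡ F' p) → ΣΔ w F ≡ ΣΔ w F'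
ΣΔ-ext w e = Σdec-ext w (λ p → pair-ext (reg (proj₁ p)) (λ a → e (a , proj₂ p)))

ΣΔ-minus : ∀ w (F G : Word × Word → ℚ) → ΣΔ w (λ p → F p ℚ.- G p) ≡ ΣΔ w F ℚ.- ΣΔ w G
ΣΔ-minus w F G = trans (Σdec-ext w (λ p → pair-minus (reg (proj₁ p)) _ _))
                       (trans (Σdec-+ w _ _) (cong (ΣΔ w F ℚ.+_) (Σdec-neg w _)))

ΣΔ-pair-swap : ∀ w (x : Free B) (φ : Word × Word → B → ℚ) → ΣΔ w (λ p → pair x (φ p)) ≡ pair x (λ c → ΣΔ w (λ p → φ p c))
ΣΔ-pair-swap w x φ = trans (Σdec-ext w (λ p → pair-swap (reg (proj₁ p)) x (λ a c → φ (a , proj₂ p) c))) (Σdec-pair-swap w x _)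

ΣΔ-Σш : ∀ u v H → Σш u v (λ w → ΣΔ w H) ≡ ΣΔ u (λ p → ΣΔ v (Σш⊗ H p))
ΣΔ-Σш u v H = trans (Σш-Σdec u v k) (Σdec-ext u (λ p → trans (Σdec-ext v (regularise p))
  (Σdec-pair-swap v (reg (proj₁ p)) (λ r a → pair (reg (proj₁ r)) (λ c → Σш⊗ H (a , proj₂ p) (c , proj₂ r))))))
  where
  k = λ (p : Word × Word) → pair (reg (proj₁ p)) (λ a → H (a , proj₂ p))
  regularise : ∀ p r → Σш⊗ k p r ≡ pair (reg (proj₁ p)) (λ a → pair (reg (proj₁ r)) (λ c → Σш⊗ H (a , proj₂ p) (c , proj₂ r)))
  regularise p r = trans (Σш-ext (proj₁ p) (proj₁ r) (λ x → Σш-pair-swap (proj₂ p) (proj₂ r) (reg x) (λ y a → H (a , y))))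
                         (reg-Σш (proj₁ p) (proj₁ r) (λ a → Σш (proj₂ p) (proj₂ r) (λ y → H (a , y))))

ΣΔ-coassoc : ∀ w (F : Word → Word → Word → ℚ) →
  ΣΔ w (λ ab → ΣΔ (proj₁ ab) (λ cd → F (proj₁ cd) (proj₂ cd) (proj₂ ab))) ≡
  ΣΔ w (λ ab → ΣΔ (proj₂ ab) (λ cd → F (proj₁ ab) (proj₁ cd) (proj₂ cd)))
ΣΔ-coassoc w F = begin
    Σdec w (λ p → pair (reg (proj₁ p)) (λ a → ΣΔ a (Φ (proj₂ p))))
  ≡⟨ Σdec-ext w (λ p → pair-reg-ΣΔ (proj₁ p) (Φ (proj₂ p))) ⟩
    Σdec w (λ p → Σdec (proj₁ p) (λ q → Ψ (proj₁ q) (proj₂ q) (proj₂ p)))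
  ≡⟨ Σdec-coassoc w Ψ ⟩
    Σdec w (λ p → Σdec (proj₂ p) (λ q → Ψ (proj₁ p) (proj₁ q) (proj₂ q)))
  ≡⟨ Σdec-ext w (λ p → Σdec-pair-swap (proj₂ p) (reg (proj₁ p)) _) ⟩
    Σdec w (λ p → pair (reg (proj₁ p)) (λ a → ΣΔ (proj₂ p) (λ cd → F a (proj₁ cd) (proj₂ cd))))
  ∎
  where
  open ≡-Reasoning
  Φ = λ (b : Word) (cd : Word × Word) → F (proj₁ cd) (proj₂ cd) b
  Ψ = λ u₁ u₂ v → pair (reg u₁) (λ a₁ → pair (reg u₂) (λ a₂ → F a₁ a₂ v))

θʳ : ℕ → Word → (Word → ℚ) → ℚ
θʳ n x g = pair (θ n x) (λ z → pair (reg z) g)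

θʳ⊗ : ℕ → (Word × Word → ℚ) → Word × Word → ℚ
θʳ⊗ n H (x , y) = θʳ (n ∸ #x₁ x) y (λ y' → H (x , y')) ℚ.+ θʳ n x (λ x' → H (x' , y))

-- Δ ∘ δₙ = (δₙ ⊗ id + id ⊙ δₙ) ∘ Δ on words, the source of property (c)
θ-ΣΔ : ∀ n w → Regular w → ∀ H → θʳ n w (λ y → ΣΔ y H) ≡ ΣΔ w (θʳ⊗ n H)
θ-ΣΔ n w rw H = begin
    pair (θ n w) (λ z → pair (reg z) (λ y → ΣΔ y H))  ≡⟨ pair-ext (θ n w) (λ z → pair-reg-ΣΔ z H) ⟩
    pair (θ n w) (λ z → Σdec z k)                     ≡⟨ θ-coderivation n w k ⟩
    Σdec w (θ⊗ n k)                                   ≡⟨ Σdec-supp w regularise ⟩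
    ΣΔ w (θʳ⊗ n H)                                    ∎
  where
  open ≡-Reasoning
  k = λ (p : Word × Word) → pair (reg (proj₁ p)) (λ a₁ → pair (reg (proj₂ p)) (λ a₂ → H (a₁ , a₂)))
  regularise : ∀ u v → u ++ v ≡ w → θ⊗ n k (u , v) ≡ pair (reg u) (λ x → θʳ⊗ n H (x , v))
  regularise u v e = sym (begin
      pair (reg u) (λ x → θʳ⊗ n H (x , v))
    ≡⟨ pair-+ (reg u) _ _ ⟩
      pair (reg u) (λ x → θʳ (n ∸ #x₁ x) v (λ y' → H (x , y'))) ℚ.+ pair (reg u) (λ x → θʳ n x (λ x' → H (x' , v)))
    ≡⟨ cong₂ ℚ._+_ right left ⟩
      pair (θ (n ∸ #x₁ u) v) (λ v' → k (u , v')) ℚ.+ pair (θ n u) (λ u' → k (u' , v))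
    ≡⟨ QP.+-comm (pair (θ (n ∸ #x₁ u) v) (λ v' → k (u , v'))) _ ⟩
      θ⊗ n k (u , v)
    ∎)
    where
    rv : Regular v
    rv = regular-suffix u v (subst Regular (sym e) rw)
    right : pair (reg u) (λ x → θʳ (n ∸ #x₁ x) v (λ y' → H (x , y'))) ≡ pair (θ (n ∸ #x₁ u) v) (λ v' → k (u , v'))
    right = trans (pair-supp (reg-supp u) (λ x rx → cong (λ m → θʳ (n ∸ m) v (λ y' → H (x , y'))) (proj₂ (proj₂ rx))))
                  (pair-swap (reg u) (θ (n ∸ #x₁ u) v) (λ x z → pair (reg z) (λ y' → H (x , y'))))
    left : pair (reg u) (λ x → θʳ n x (λ x' → H (x' , v))) ≡ pair (θ n u) (λ u' → k (u' , v))
    left = trans (sym (θ-reg n u (λ x' → H (x' , v))))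
                 (pair-ext (θ n u) (λ u' → pair-ext (reg u') (λ a₁ → sym (pair-reg-regular rv (λ a₂ → H (a₁ , a₂))))))

-- The antipode on words

sgn : ℕ → ℚ
sgn zero = 1ℚ
sgn (suc n) = ℚ.- sgn n

-- the telescoping sum behind the left antipode identity, generalised so
-- that the induction on w goes through: the first letter of w moves onto r
antipodeˡ-value : Word → Word → (Word → ℚ) → ℚ
antipodeˡ-value [] w G = ε₀ w ℚ.* G []
antipodeˡ-value (a ∷ r) w G = Σш r w (G ∘ (a ∷_))

Σdec-antipodeˡ-++ : ∀ w r G →
  Σdec w (λ p → sgn (length (proj₁ p)) ℚ.* Σш (reverse (proj₁ p) ++ r) (proj₂ p) G) ≡ antipodeˡ-value r w G
Σdec-antipodeˡ-++ [] r G = trans (Σdec-[] _) (trans (QP.*-identityˡ _) (trans (Σш-[]ʳ r G) (empty r)))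
  where
  empty : ∀ r → G r ≡ antipodeˡ-value r [] G
  empty [] = sym (QP.*-identityˡ (G []))
  empty (a ∷ r) = sym (Σш-[]ʳ r (G ∘ (a ∷_)))
Σdec-antipodeˡ-++ (b ∷ w) r G = begin
    Σdec (b ∷ w) F
  ≡⟨ Σdec-∷ b w F ⟩
    F ([] , b ∷ w) ℚ.+ Σdec w (λ p → F (b ∷ proj₁ p , proj₂ p))
  ≡⟨ cong₂ ℚ._+_ (QP.*-identityˡ (Σш r (b ∷ w) G))
       (trans (Σdec-ext w move-b) (trans (Σdec-neg w _) (cong ℚ.-_ (Σdec-antipodeˡ-++ w (b ∷ r) G)))) ⟩
    Σш r (b ∷ w) G ℚ.- antipodeˡ-value (b ∷ r) w G
  ≡⟨ telescope r ⟩
    antipodeˡ-value r (b ∷ w) G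
  ∎
  where
  open ≡-Reasoning
  F = λ (p : Word × Word) → sgn (length (proj₁ p)) ℚ.* Σш (reverse (proj₁ p) ++ r) (proj₂ p) G
  move-b : ∀ p → F (b ∷ proj₁ p , proj₂ p) ≡ ℚ.- (sgn (length (proj₁ p)) ℚ.* Σш (reverse (proj₁ p) ++ b ∷ r) (proj₂ p) G)
  move-b (u , v) = begin
      ℚ.- sgn (length u) ℚ.* Σш (reverse (b ∷ u) ++ r) v G
    ≡⟨ cong (λ z → ℚ.- sgn (length u) ℚ.* Σш z v G) (trans (cong (_++ r) (LP.unfold-reverse b u)) (LP.++-assoc (reverse u) [ b ] r)) ⟩
      ℚ.- sgn (length u) ℚ.* Σш (reverse u ++ b ∷ r) v G
    ≡⟨ sym (QP.neg-distribˡ-* (sgn (length u)) _) ⟩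
      ℚ.- (sgn (length u) ℚ.* Σш (reverse u ++ b ∷ r) v G)
    ∎
  telescope : ∀ r → Σш r (b ∷ w) G ℚ.- Σш r w (G ∘ (b ∷_)) ≡ antipodeˡ-value r (b ∷ w) G
  telescope [] = trans (cong₂ ℚ._-_ (Σш-[]ˡ (b ∷ w) G) (Σш-[]ˡ w (G ∘ (b ∷_))))
                       (trans (QP.+-inverseʳ (G (b ∷ w))) (sym (QP.*-zeroˡ (G []))))
  telescope (a ∷ r) = trans (cong (ℚ._- Σш (a ∷ r) w (G ∘ (b ∷_))) (Σш-∷ a r b w G))
    (solve 2 (λ x y → (x :+ y) :- y := x) refl (Σш r (b ∷ w) (G ∘ (a ∷_))) (Σш (a ∷ r) w (G ∘ (b ∷_))))

Σdec-antipodeˡ : ∀ w G → Σdec w (λ p → sgn (length (proj₁ p)) ℚ.* Σш (reverse (proj₁ p)) (proj₂ p) G) ≡ ε₀ w ℚ.* G []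
Σdec-antipodeˡ w G = trans
  (Σdec-ext w (λ p → cong (λ z → sgn (length (proj₁ p)) ℚ.* Σш z (proj₂ p) G) (sym (LP.++-identityʳ (reverse (proj₁ p))))))
  (Σdec-antipodeˡ-++ w [] G)

Σш-[a]-∷ʳ : ∀ a v b g → Σш [ a ] (v ++ [ b ]) g ≡ g ((v ++ [ b ]) ++ [ a ]) ℚ.+ Σш [ a ] v (λ w → g (w ++ [ b ]))
Σш-[a]-∷ʳ a [] b g = begin
    Σш [ a ] [ b ] g                                           ≡⟨ Σш-∷ a [] b [] g ⟩
    Σш [] [ b ] (g ∘ (a ∷_)) ℚ.+ Σш [ a ] [] (g ∘ (b ∷_))     ≡⟨ cong₂ ℚ._+_ (Σш-[]ˡ [ b ] _) (Σш-[]ʳ [ a ] _) ⟩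
    g (a ∷ [ b ]) ℚ.+ g (b ∷ [ a ])                           ≡⟨ QP.+-comm (g (a ∷ [ b ])) _ ⟩
    g (b ∷ [ a ]) ℚ.+ g (a ∷ [ b ])                           ≡⟨ cong (g (b ∷ [ a ]) ℚ.+_) (sym (Σш-[]ʳ [ a ] _)) ⟩
    g (b ∷ [ a ]) ℚ.+ Σш [ a ] [] (λ w → g (w ++ [ b ]))     ∎
  where open ≡-Reasoning
Σш-[a]-∷ʳ a (d ∷ v) b g = begin
    Σш [ a ] (d ∷ v ++ [ b ]) g
  ≡⟨ Σш-x-∷ ⟩
    g (a ∷ d ∷ v ++ [ b ]) ℚ.+ Σш [ a ] (v ++ [ b ]) (g ∘ (d ∷_))
  ≡⟨ cong (g (a ∷ d ∷ v ++ [ b ]) ℚ.+_) (Σш-[a]-∷ʳ a v b (g ∘ (d ∷_))) ⟩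
    g (a ∷ d ∷ v ++ [ b ]) ℚ.+ (g (d ∷ (v ++ [ b ]) ++ [ a ]) ℚ.+ Σш [ a ] v (λ w → g (d ∷ w ++ [ b ])))
  ≡⟨ solve 3 (λ x y z → x :+ (y :+ z) := y :+ (x :+ z)) refl (g (a ∷ d ∷ v ++ [ b ])) (g (d ∷ (v ++ [ b ]) ++ [ a ])) _ ⟩
    g (d ∷ (v ++ [ b ]) ++ [ a ]) ℚ.+ (g (a ∷ d ∷ v ++ [ b ]) ℚ.+ Σш [ a ] v (λ w → g (d ∷ w ++ [ b ])))
  ≡⟨ cong (g (d ∷ (v ++ [ b ]) ++ [ a ]) ℚ.+_) (sym Σш-x-∷) ⟩
    g (d ∷ (v ++ [ b ]) ++ [ a ]) ℚ.+ Σш [ a ] (d ∷ v) (λ w → g (w ++ [ b ]))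
  ∎
  where
  open ≡-Reasoning
  Σш-x-∷ : ∀ {y} {h : Word → ℚ} → Σш [ a ] (d ∷ y) h ≡ h (a ∷ d ∷ y) ℚ.+ Σш [ a ] y (h ∘ (d ∷_))
  Σш-x-∷ {y} {h} = trans (Σш-∷ a [] d y h) (cong (ℚ._+ Σш [ a ] y (h ∘ (d ∷_))) (Σш-[]ˡ (d ∷ y) _))

Σш-∷ʳ : ∀ u v a b g → Σш (u ++ [ a ]) (v ++ [ b ]) g ≡
  Σш u (v ++ [ b ]) (λ w → g (w ++ [ a ])) ℚ.+ Σш (u ++ [ a ]) v (λ w → g (w ++ [ b ]))
Σш-∷ʳ [] v a b g = trans (Σш-[a]-∷ʳ a v b g) (cong (ℚ._+ Σш [ a ] v (λ w → g (w ++ [ b ]))) (sym (Σш-[]ˡ (v ++ [ b ]) (λ w → g (w ++ [ a ])))))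
Σш-∷ʳ (c ∷ u) [] a b g = begin
    Σш (c ∷ u ++ [ a ]) [ b ] g
  ≡⟨ Σш-comm (c ∷ u ++ [ a ]) [ b ] g ⟩
    Σш [ b ] (c ∷ u ++ [ a ]) g
  ≡⟨ Σш-∷ʳ [] (c ∷ u) b a g ⟩
    Σш [] (c ∷ u ++ [ a ]) (λ w → g (w ++ [ b ])) ℚ.+ Σш [ b ] (c ∷ u) (λ w → g (w ++ [ a ]))
  ≡⟨ QP.+-comm (Σш [] (c ∷ u ++ [ a ]) (λ w → g (w ++ [ b ]))) _ ⟩
    Σш [ b ] (c ∷ u) (λ w → g (w ++ [ a ])) ℚ.+ Σш [] (c ∷ u ++ [ a ]) (λ w → g (w ++ [ b ]))
  ≡⟨ cong₂ ℚ._+_ (Σш-comm [ b ] (c ∷ u) _) (Σш-comm [] (c ∷ u ++ [ a ]) _) ⟩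
    Σш (c ∷ u) [ b ] (λ w → g (w ++ [ a ])) ℚ.+ Σш (c ∷ u ++ [ a ]) [] (λ w → g (w ++ [ b ]))
  ∎
  where open ≡-Reasoning
Σш-∷ʳ (c ∷ u) (d ∷ v) a b g = begin
    Σш (c ∷ u ++ [ a ]) (d ∷ v ++ [ b ]) g
  ≡⟨ Σш-∷ c (u ++ [ a ]) d (v ++ [ b ]) g ⟩
    Σш (u ++ [ a ]) (d ∷ v ++ [ b ]) (g ∘ (c ∷_)) ℚ.+ Σш (c ∷ u ++ [ a ]) (v ++ [ b ]) (g ∘ (d ∷_))
  ≡⟨ cong₂ ℚ._+_ (Σш-∷ʳ u (d ∷ v) a b (g ∘ (c ∷_))) (Σш-∷ʳ (c ∷ u) v a b (g ∘ (d ∷_))) ⟩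
    (T₁ ℚ.+ T₂) ℚ.+ (T₃ ℚ.+ T₄)
  ≡⟨ solve 4 (λ t₁ t₂ t₃ t₄ → (t₁ :+ t₂) :+ (t₃ :+ t₄) := (t₁ :+ t₃) :+ (t₂ :+ t₄)) refl T₁ T₂ T₃ T₄ ⟩
    (T₁ ℚ.+ T₃) ℚ.+ (T₂ ℚ.+ T₄)
  ≡⟨ cong₂ ℚ._+_ (sym (Σш-∷ c u d (v ++ [ b ]) (λ w → g (w ++ [ a ]))))
                 (sym (Σш-∷ c (u ++ [ a ]) d v (λ w → g (w ++ [ b ])))) ⟩
    Σш (c ∷ u) (d ∷ v ++ [ b ]) (λ w → g (w ++ [ a ])) ℚ.+ Σш (c ∷ u ++ [ a ]) (d ∷ v) (λ w → g (w ++ [ b ]))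
  ∎
  where
  open ≡-Reasoning
  T₁ = Σш u (d ∷ v ++ [ b ]) (λ w → g (c ∷ w ++ [ a ]))
  T₂ = Σш (u ++ [ a ]) (d ∷ v) (λ w → g (c ∷ w ++ [ b ]))
  T₃ = Σш (c ∷ u) (v ++ [ b ]) (λ w → g (d ∷ w ++ [ a ]))
  T₄ = Σш (c ∷ u ++ [ a ]) v (λ w → g (d ∷ w ++ [ b ]))

Σш-reverse : ∀ u v G → Σш u v (G ∘ reverse) ≡ Σш (reverse u) (reverse v) G
Σш-reverse [] v G = trans (Σш-[]ˡ v (G ∘ reverse)) (sym (Σш-[]ˡ (reverse v) G))
Σш-reverse (a ∷ u) [] G = trans (Σш-[]ʳ (a ∷ u) (G ∘ reverse)) (sym (Σш-[]ʳ (reverse (a ∷ u)) G))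
Σш-reverse (a ∷ u) (b ∷ v) G = begin
    Σш (a ∷ u) (b ∷ v) (G ∘ reverse)
  ≡⟨ Σш-∷-ext a u b v _ _ (λ w → cong G (LP.unfold-reverse a w)) (λ w → cong G (LP.unfold-reverse b w)) ⟩
    Σш u (b ∷ v) ((λ w → G (w ++ [ a ])) ∘ reverse) ℚ.+ Σш (a ∷ u) v ((λ w → G (w ++ [ b ])) ∘ reverse)
  ≡⟨ cong₂ ℚ._+_ (Σш-reverse u (b ∷ v) _) (Σш-reverse (a ∷ u) v _) ⟩
    Σш (reverse u) (reverse (b ∷ v)) (λ w → G (w ++ [ a ])) ℚ.+ Σш (reverse (a ∷ u)) (reverse v) (λ w → G (w ++ [ b ]))
  ≡⟨ cong₂ (λ z t → Σш (reverse u) z (λ w → G (w ++ [ a ])) ℚ.+ Σш t (reverse v) (λ w → G (w ++ [ b ])))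
           (LP.unfold-reverse b v) (LP.unfold-reverse a u) ⟩
    Σш (reverse u) (reverse v ++ [ b ]) (λ w → G (w ++ [ a ])) ℚ.+ Σш (reverse u ++ [ a ]) (reverse v) (λ w → G (w ++ [ b ]))
  ≡⟨ sym (Σш-∷ʳ (reverse u) (reverse v) a b G) ⟩
    Σш (reverse u ++ [ a ]) (reverse v ++ [ b ]) G
  ≡⟨ sym (cong₂ (λ z t → Σш z t G) (LP.unfold-reverse a u) (LP.unfold-reverse b v)) ⟩
    Σш (reverse (a ∷ u)) (reverse (b ∷ v)) G
  ∎
  where open ≡-Reasoning

ε₀-reverse : ∀ w → ε₀ (reverse w) ≡ ε₀ w
ε₀-reverse [] = refl
ε₀-reverse (a ∷ w) rewrite LP.unfold-reverse a w = ε₀-∷ʳ (reverse w)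
  where
  ε₀-∷ʳ : ∀ u → ε₀ (u ++ [ a ]) ≡ 0ℚ
  ε₀-∷ʳ [] = refl
  ε₀-∷ʳ (_ ∷ _) = refl

-- The right identity is the left one for the reversed word.
Σdec-antipodeʳ : ∀ w G → Σdec w (λ p → sgn (length (proj₂ p)) ℚ.* Σш (proj₁ p) (reverse (proj₂ p)) G) ≡ ε₀ w ℚ.* G []
Σdec-antipodeʳ w G = begin
    Σdec w (λ p → sgn (length (proj₂ p)) ℚ.* Σш (proj₁ p) (reverse (proj₂ p)) G)
  ≡⟨ Σdec-reverse w _ ⟩
    Σdec (reverse w) (λ p → sgn (length (reverse (proj₁ p))) ℚ.* Σш (reverse (proj₂ p)) (reverse (reverse (proj₁ p))) G)
  ≡⟨ Σdec-ext (reverse w) (λ p → cong₂ ℚ._*_ (cong sgn (LP.length-reverse (proj₁ p))) (mirror (proj₁ p) (proj₂ p))) ⟩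
    Σdec (reverse w) (λ p → sgn (length (proj₁ p)) ℚ.* Σш (reverse (proj₁ p)) (proj₂ p) (G ∘ reverse))
  ≡⟨ Σdec-antipodeˡ (reverse w) (G ∘ reverse) ⟩
    ε₀ (reverse w) ℚ.* G []
  ≡⟨ cong (ℚ._* G []) (ε₀-reverse w) ⟩
    ε₀ w ℚ.* G []
  ∎
  where
  open ≡-Reasoning
  mirror : ∀ u v → Σш (reverse v) (reverse (reverse u)) G ≡ Σш (reverse u) v (G ∘ reverse)
  mirror u v = begin
    Σш (reverse v) (reverse (reverse u)) G  ≡⟨ cong (λ z → Σш (reverse v) z G) (LP.reverse-involutive u) ⟩
    Σш (reverse v) u G                      ≡⟨ Σш-comm (reverse v) u G ⟩
    Σш u (reverse v) G                      ≡⟨ cong (λ z → Σш z (reverse v) G) (sym (LP.reverse-involutive u)) ⟩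
    Σш (reverse (reverse u)) (reverse v) G  ≡⟨ sym (Σш-reverse (reverse u) v G) ⟩
    Σш (reverse u) v (G ∘ reverse)          ∎

reg-antipode : ∀ u ψ → pair (reg u) (λ a → sgn (length a) ℚ.* pair (reg (reverse a)) ψ) ≡ sgn (length u) ℚ.* pair (reg (reverse u)) ψ
reg-antipode u ψ = kills-x₀ш⇒pair-reg kills u
  where
  kills : KillsX₀Ideal (λ a → sgn (length a) ℚ.* pair (reg (reverse a)) ψ)
  kills v = begin
      Σш [ x₀ ] v (λ a → sgn (length a) ℚ.* pair (reg (reverse a)) ψ)
    ≡⟨ Σш-supp [ x₀ ] v (sh-additive [ x₀ ] v) (λ a la → cong (λ z → sgn z ℚ.* pair (reg (reverse a)) ψ) (proj₁ la)) ⟩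
      Σш [ x₀ ] v (λ a → sgn (suc (length v)) ℚ.* pair (reg (reverse a)) ψ)
    ≡⟨ Σш-* (sgn (suc (length v))) [ x₀ ] v _ ⟩
      sgn (suc (length v)) ℚ.* Σш [ x₀ ] v ((λ a → pair (reg a) ψ) ∘ reverse)
    ≡⟨ cong (sgn (suc (length v)) ℚ.*_) (trans (Σш-reverse [ x₀ ] v (λ a → pair (reg a) ψ)) (reg-kills-x₀ш ψ (reverse v))) ⟩
      sgn (suc (length v)) ℚ.* 0ℚ
    ≡⟨ QP.*-zeroʳ (sgn (suc (length v))) ⟩
      0ℚ
    ∎
    where open ≡-Reasoning

x₀^-∷ʳ : ∀ n (v : Word) → x₀^ (suc n) ++ v ≡ x₀^ n ++ x₀ ∷ v
x₀^-∷ʳ zero v = refl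
x₀^-∷ʳ (suc n) v = cong (x₀ ∷_) (x₀^-∷ʳ n v)

ρ⁻¹-aux-x₀^ : ∀ n e w → ρ⁻¹-aux n (x₀^ e ++ w) ≡ ρ⁻¹-aux (e + n) w
ρ⁻¹-aux-x₀^ n zero w = refl
ρ⁻¹-aux-x₀^ n (suc e) w = trans (ρ⁻¹-aux-x₀^ (suc n) e w) (cong (λ z → ρ⁻¹-aux z w) (NP.+-suc e n))

ρ⁻¹∘ρ : ∀ s → ρ⁻¹ (ρ s) ≡ s
ρ⁻¹∘ρ [] = refl
ρ⁻¹∘ρ (e ∷ s) = trans (ρ⁻¹-aux-x₀^ 0 e (x₁ ∷ ρ s)) (cong₂ _∷_ (NP.+-identityʳ e) (ρ⁻¹∘ρ s))

regular-block : ∀ e {w} → Regular w → Regular (x₀^ e ++ x₁ ∷ w)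
regular-block zero r = regular-x₁∷ r
regular-block (suc zero) r = x₀ ∷ᴿ regular-block zero r
regular-block (suc (suc e)) r = x₀ ∷ᴿ regular-block (suc e) r

ρ-regular : ∀ s → Regular (ρ s)
ρ-regular [] = []ᴿ
ρ-regular (e ∷ s) = regular-block e (ρ-regular s)

ρ∘ρ⁻¹-aux : ∀ n {w} → Regular w → 0 ℕ.< length w → ρ (ρ⁻¹-aux n w) ≡ x₀^ n ++ w
ρ∘ρ⁻¹-aux n [x₁]ᴿ _ = refl
ρ∘ρ⁻¹-aux n (x₀ ∷ᴿ r) _ = trans (ρ∘ρ⁻¹-aux (suc n) r (ℕ.s≤s ℕ.z≤n)) (x₀^-∷ʳ n _)
ρ∘ρ⁻¹-aux n (x₁ ∷ᴿ r) _ = cong (λ z → x₀^ n ++ x₁ ∷ z) (ρ∘ρ⁻¹-aux 0 r (ℕ.s≤s ℕ.z≤n))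

ρ∘ρ⁻¹ : ∀ {w} → Regular w → ρ (ρ⁻¹ w) ≡ w
ρ∘ρ⁻¹ []ᴿ = refl
ρ∘ρ⁻¹ [x₁]ᴿ = refl
ρ∘ρ⁻¹ (a ∷ᴿ r) = ρ∘ρ⁻¹-aux 0 (a ∷ᴿ r) (ℕ.s≤s ℕ.z≤n)

dep-ρ⁻¹-aux : ∀ n w → dep (ρ⁻¹-aux n w) ≡ #x₁ w
dep-ρ⁻¹-aux n [] = refl
dep-ρ⁻¹-aux n (x₀ ∷ w) = dep-ρ⁻¹-aux (suc n) w
dep-ρ⁻¹-aux n (x₁ ∷ w) = cong suc (dep-ρ⁻¹-aux 0 w)

dep-ρ⁻¹ : ∀ w → dep (ρ⁻¹ w) ≡ #x₁ w
dep-ρ⁻¹ = dep-ρ⁻¹-aux 0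

#x₁-ρ : ∀ s → #x₁ (ρ s) ≡ dep s
#x₁-ρ s = trans (sym (dep-ρ⁻¹ (ρ s))) (cong dep (ρ⁻¹∘ρ s))

length-ρ : ∀ s → length (ρ s) ≡ wt s
length-ρ [] = refl
length-ρ (e ∷ s) = trans (LP.length-++ (x₀^ e)) (trans (cong₂ _+_ (LP.length-replicate e) (cong suc (length-ρ s))) (NP.+-suc e (wt s)))

wt-ρ⁻¹ : ∀ {w} → Regular w → wt (ρ⁻¹ w) ≡ length w
wt-ρ⁻¹ {w} r = trans (sym (length-ρ (ρ⁻¹ w))) (cong length (ρ∘ρ⁻¹ r))

ε-ρ⁻¹ : ∀ {w} → Regular w → ε (ρ⁻¹ w) ≡ ε₀ w
ε-ρ⁻¹ []ᴿ = refl
ε-ρ⁻¹ {a ∷ w} r = ε-nonempty (ρ⁻¹ (a ∷ w)) (subst (0 ℕ.<_) (sym (dep-ρ⁻¹ (a ∷ w))) (regular-#x₁ r))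
  where
  ε-nonempty : ∀ s → 0 ℕ.< dep s → ε s ≡ 0ℚ
  ε-nonempty (_ ∷ _) _ = refl

pair-θ-block : ∀ n e w g → pair (θ (suc n) (x₀^ e ++ x₁ ∷ w)) g ≡
  nat (suc e) ℚ.* g (x₀^ (suc e) ++ x₁ ∷ w) ℚ.+ pair (θ n w) (λ y → g (x₀^ e ++ x₁ ∷ y))
pair-θ-block n zero w g = trans (pair-θ-∷ x₁ n w g)
  (cong (ℚ._+ pair (θ n w) (g ∘ (x₁ ∷_))) (sym (trans (cong (ℚ._* g (x₀ ∷ x₁ ∷ w)) nat-1) (QP.*-identityˡ (g (x₀ ∷ x₁ ∷ w))))))
pair-θ-block n (suc e) w g = begin
    pair (θ (suc n) (x₀ ∷ x₀^ e ++ x₁ ∷ w)) g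
  ≡⟨ pair-θ-∷ x₀ n (x₀^ e ++ x₁ ∷ w) g ⟩
    G ℚ.+ pair (θ (suc n) (x₀^ e ++ x₁ ∷ w)) (g ∘ (x₀ ∷_))
  ≡⟨ cong (G ℚ.+_) (pair-θ-block n e w (g ∘ (x₀ ∷_))) ⟩
    G ℚ.+ (nat (suc e) ℚ.* G ℚ.+ T)
  ≡⟨ solve 3 (λ g n t → g :+ (n :* g :+ t) := (con 1ℚ :+ n) :* g :+ t) refl G (nat (suc e)) T ⟩
    (1ℚ ℚ.+ nat (suc e)) ℚ.* G ℚ.+ T
  ≡⟨ cong (λ z → z ℚ.* G ℚ.+ T) (sym (nat-suc (suc e))) ⟩
    nat (suc (suc e)) ℚ.* G ℚ.+ T
  ∎
  where
  open ≡-Reasoning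
  G = g (x₀^ (suc (suc e)) ++ x₁ ∷ w)
  T = pair (θ n w) (λ y → g (x₀ ∷ x₀^ e ++ x₁ ∷ y))

θ-ρ : ∀ n s g → n ℕ.≤ dep s → pair (θ n (ρ s)) g ≡ pair (take n (bumps s)) (g ∘ ρ)
θ-ρ zero s g _ = trans (pair-[] g) (sym (pair-[] (g ∘ ρ)))
θ-ρ (suc n) (e ∷ s) g (ℕ.s≤s le) = begin
    pair (θ (suc n) (x₀^ e ++ x₁ ∷ ρ s)) g
  ≡⟨ pair-θ-block n e (ρ s) g ⟩
    nat (suc e) ℚ.* g (ρ (suc e ∷ s)) ℚ.+ pair (θ n (ρ s)) (λ y → g (x₀^ e ++ x₁ ∷ y))
  ≡⟨ cong (nat (suc e) ℚ.* g (ρ (suc e ∷ s)) ℚ.+_) (θ-ρ n s (λ y → g (x₀^ e ++ x₁ ∷ y)) le) ⟩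
    nat (suc e) ℚ.* g (ρ (suc e ∷ s)) ℚ.+ pair (take n (bumps s)) (λ t → g (ρ (e ∷ t)))
  ≡⟨ cong (nat (suc e) ℚ.* g (ρ (suc e ∷ s)) ℚ.+_) (sym (trans (cong (λ z → pair z (g ∘ ρ)) (LP.take-map n (bumps s))) (pair-map (e ∷_) (take n (bumps s)) (g ∘ ρ)))) ⟩
    nat (suc e) ℚ.* g (ρ (suc e ∷ s)) ℚ.+ pair (take n (map (λ p → (proj₁ p , e ∷ proj₂ p)) (bumps s))) (g ∘ ρ)
  ≡⟨ sym (pair-∷ _ _ _ (g ∘ ρ)) ⟩
    pair (take (suc n) (bumps (e ∷ s))) (g ∘ ρ)
  ∎
  where open ≡-Reasoning

-- negative indices are clamped to 0, matching δᵢ = 0 for i ≤ 0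
toℕ₀ : ℤ → ℕ
toℕ₀ (+ n) = n
toℕ₀ -[1+ n ] = 0

toℕ₀-⊖ : ∀ m n → toℕ₀ (m ℤ.⊖ n) ≡ m ∸ n
toℕ₀-⊖ m zero rewrite ZP.⊖-≥ {m} {0} ℕ.z≤n = refl
toℕ₀-⊖ zero (suc n) rewrite ZP.⊖-< {0} {suc n} (ℕ.s≤s ℕ.z≤n) = refl
toℕ₀-⊖ (suc m) (suc n) rewrite ZP.[1+m]⊖[1+n]≡m⊖n m n = toℕ₀-⊖ m n

toℕ₀-sub : ∀ m n → toℕ₀ ((+ m) ℤ.- (+ n)) ≡ m ∸ n
toℕ₀-sub m n rewrite ZP.[+m]-[+n]≡m⊖n m n = toℕ₀-⊖ m n

toℕ₀-pred : ∀ i → toℕ₀ (i ℤ.- ℤ.1ℤ) ≡ toℕ₀ i ∸ 1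
toℕ₀-pred (+ zero) = refl
toℕ₀-pred (+ suc n) = refl
toℕ₀-pred -[1+ n ] = refl

δ-via-θ : ∀ i s h → pair (δ i s) h ≡ θʳ (toℕ₀ i) (ρ s) (h ∘ ρ⁻¹)
δ-via-θ -[1+ n ] s h = trans (pair-[] h) (sym (pair-θ-0 (ρ s) _))
δ-via-θ (+ n) s h with n ≤? dep s
... | yes n≤dep = sym (trans (θ-ρ n s _ n≤dep)
        (pair-ext (take n (bumps s)) (λ t → trans (pair-reg-regular (ρ-regular t) (h ∘ ρ⁻¹)) (cong h (ρ⁻¹∘ρ t)))))
... | no n≰dep = sym (begin
    θʳ n (ρ s) (h ∘ ρ⁻¹)               ≡⟨ θ-beyond-#x₁ n (ρ s) _ (subst (ℕ._< n) (sym (#x₁-ρ s)) (NP.≰⇒> n≰dep)) ⟩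
    Σш [ x₀ ] (ρ s) (λ w → pair (reg w) (h ∘ ρ⁻¹)) ≡⟨ reg-kills-x₀ш (h ∘ ρ⁻¹) (ρ s) ⟩
    0ℚ                                 ≡⟨ sym (pair-[] h) ⟩
    pair [] h                          ∎)
  where open ≡-Reasoning

D-via-θ : ∀ i s h → pair (D i s) h ≡ θʳ (toℕ₀ i) (ρ s) (h ∘ ρ⁻¹) ℚ.- θʳ (toℕ₀ i ∸ 1) (ρ s) (h ∘ ρ⁻¹)
D-via-θ i s h = trans (pair-⊖ (δ i s) (δ (i ℤ.- ℤ.1ℤ) s) h)
  (cong₂ ℚ._-_ (δ-via-θ i s h) (trans (δ-via-θ (i ℤ.- ℤ.1ℤ) s h) (cong (λ z → θʳ z (ρ s) (h ∘ ρ⁻¹)) (toℕ₀-pred i))))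

take-bump : ∀ s (i : Fin (dep s)) h → pair (take (suc (toℕ i)) (bumps s)) h ≡
   pair (take (toℕ i) (bumps s)) h ℚ.+ nat (val (lookup s i)) ℚ.* h (updateAt s i suc)
take-bump (e ∷ s) fz h = begin
    pair ((nat (suc e) , suc e ∷ s) ∷ []) h  ≡⟨ pair-∷ (nat (suc e)) (suc e ∷ s) [] h ⟩
    X ℚ.+ pair [] h                          ≡⟨ cong (X ℚ.+_) (pair-[] h) ⟩
    X ℚ.+ 0ℚ                                 ≡⟨ QP.+-comm X 0ℚ ⟩
    0ℚ ℚ.+ X                                 ≡⟨ cong (ℚ._+ X) (sym (pair-[] h)) ⟩
    pair [] h ℚ.+ X                          ∎
  where
  open ≡-Reasoning
  X = nat (suc e) ℚ.* h (suc e ∷ s)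
take-bump (e ∷ s) (fs i) h = begin
    pair (take (suc (suc (toℕ i))) (bumps (e ∷ s))) h
  ≡⟨ pair-∷ _ _ _ h ⟩
    H₀ ℚ.+ pair (take (suc (toℕ i)) (map f (bumps s))) h
  ≡⟨ cong (H₀ ℚ.+_) (trans (cong (λ z → pair z h) (LP.take-map (suc (toℕ i)) (bumps s))) (pair-map (e ∷_) _ h)) ⟩
    H₀ ℚ.+ pair (take (suc (toℕ i)) (bumps s)) (h ∘ (e ∷_))
  ≡⟨ cong (H₀ ℚ.+_) (take-bump s i (h ∘ (e ∷_))) ⟩
    H₀ ℚ.+ (pair (take (toℕ i) (bumps s)) (h ∘ (e ∷_)) ℚ.+ Z)
  ≡⟨ sym (QP.+-assoc H₀ _ Z) ⟩
    (H₀ ℚ.+ pair (take (toℕ i) (bumps s)) (h ∘ (e ∷_))) ℚ.+ Z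
  ≡⟨ cong (λ z → (H₀ ℚ.+ z) ℚ.+ Z) (sym (trans (cong (λ z → pair z h) (LP.take-map (toℕ i) (bumps s))) (pair-map (e ∷_) _ h))) ⟩
    (H₀ ℚ.+ pair (take (toℕ i) (map f (bumps s))) h) ℚ.+ Z
  ≡⟨ cong (ℚ._+ Z) (sym (pair-∷ _ _ _ h)) ⟩
    pair (take (suc (toℕ i)) (bumps (e ∷ s))) h ℚ.+ Z
  ∎
  where
  open ≡-Reasoning
  f = λ (p : ℚ × Idx) → (proj₁ p , e ∷ proj₂ p)
  H₀ = nat (suc e) ℚ.* h (suc e ∷ s)
  Z = nat (val (lookup s i)) ℚ.* h (e ∷ updateAt s i suc)

D-bump : ∀ s (i : Fin (dep s)) h → pair (D (+ suc (toℕ i)) s) h ≡ nat (val (lookup s i)) ℚ.* h (updateAt s i suc)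
D-bump s i h with suc (toℕ i) ≤? dep s | toℕ i ≤? dep s
... | yes _ | yes _ = trans (pair-⊖ (take (suc (toℕ i)) (bumps s)) _ h)
      (trans (cong (ℚ._- pair (take (toℕ i) (bumps s)) h) (take-bump s i h))
        (solve 2 (λ a b → (a :+ b) :- a := b) refl (pair (take (toℕ i) (bumps s)) h) _))
... | no ¬p | _ = ⊥-elim (¬p (FP.toℕ<n i))
... | yes _ | no ¬p = ⊥-elim (¬p (NP.<⇒≤ (FP.toℕ<n i)))

Δʷ : Word → Free (Word × Word)
Δʷ w = lin (λ p → reg (proj₁ p) ⊗ᵥ basis (proj₂ p)) (formalSum (dec w))

pair-Δʷ : ∀ w H → pair (Δʷ w) H ≡ ΣΔ w H
pair-Δʷ w H = begin
    pair (Δʷ w) H                                                 ≡⟨ pair-lin _ (formalSum (dec w)) H ⟩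
    pair (formalSum (dec w)) (λ p → pair (reg (proj₁ p) ⊗ᵥ basis (proj₂ p)) H) ≡⟨ pair-formalSum-dec w _ ⟩
    Σdec w (λ p → pair (reg (proj₁ p) ⊗ᵥ basis (proj₂ p)) H)      ≡⟨ Σdec-ext w (λ p → trans (pair-⊗ (reg (proj₁ p)) (basis (proj₂ p)) H)
                                                                        (pair-ext (reg (proj₁ p)) (λ a → pair-basis (proj₂ p) _))) ⟩
    ΣΔ w H                                                        ∎
  where open ≡-Reasoning

ρ² : Idx × Idx → Word × Word
ρ² (s , t) = (ρ s , ρ t)

ρ⁻¹² : Word × Word → Idx × Idx
ρ⁻¹² (x , y) = (ρ⁻¹ x , ρ⁻¹ y)

Δrec : Idx → 𝓗⊗𝓗
Δrec s = map (λ p → (proj₁ p , ρ⁻¹² (proj₂ p))) (Δʷ (ρ s))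

pair-Δrec : ∀ s (h : Idx × Idx → ℚ) → pair (Δrec s) h ≡ ΣΔ (ρ s) (h ∘ ρ⁻¹²)
pair-Δrec s h = trans (pair-map ρ⁻¹² (Δʷ (ρ s)) h) (pair-Δʷ (ρ s) (h ∘ ρ⁻¹²))

pair-Δrec-regular : ∀ {w} → Regular w → ∀ (h : Idx × Idx → ℚ) → pair (Δrec (ρ⁻¹ w)) h ≡ ΣΔ w (h ∘ ρ⁻¹²)
pair-Δrec-regular {w} r h = trans (pair-Δrec (ρ⁻¹ w) h) (cong (λ z → ΣΔ z (h ∘ ρ⁻¹²)) (ρ∘ρ⁻¹ r))

pair-lin-on-Δrec : (f : Idx × Idx → Free B) (s : Idx) (h : B → ℚ) → pair (lin f (Δrec s)) h ≡ ΣΔ (ρ s) (λ xy → pair (f (ρ⁻¹² xy)) h)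
pair-lin-on-Δrec f s h = trans (pair-lin f (Δrec s) h) (pair-Δrec s _)

pair-lin-Δrec : ∀ x (h : Idx × Idx → ℚ) → pair (lin Δrec x) h ≡ pair x (λ s → ΣΔ (ρ s) (h ∘ ρ⁻¹²))
pair-lin-Δrec x h = trans (pair-lin Δrec x h) (pair-ext x (λ s → pair-Δrec s h))

pair-shB : ∀ s t (h : Idx → ℚ) → pair (shB s t) h ≡ Σш (ρ s) (ρ t) (h ∘ ρ⁻¹)
pair-shB s t h = begin
    pair (map (λ w → (1ℚ , ρ⁻¹ w)) (sh (ρ s) (ρ t))) h    ≡⟨ cong (λ z → pair z h) (LP.map-∘ (sh (ρ s) (ρ t))) ⟩
    pair (formalSum (map ρ⁻¹ (sh (ρ s) (ρ t)))) h         ≡⟨ pair-formalSum (map ρ⁻¹ (sh (ρ s) (ρ t))) h ⟩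
    Σlist (map ρ⁻¹ (sh (ρ s) (ρ t))) h                    ≡⟨ Σlist-map ρ⁻¹ (sh (ρ s) (ρ t)) h ⟩
    Σlist (sh (ρ s) (ρ t)) (h ∘ ρ⁻¹)                      ≡⟨ sym (pair-formalSum (sh (ρ s) (ρ t)) _) ⟩
    pair (formalSum (sh (ρ s) (ρ t))) (h ∘ ρ⁻¹)           ≡⟨ pair-formalSum-sh (ρ s) (ρ t) _ ⟩
    Σш (ρ s) (ρ t) (h ∘ ρ⁻¹)                              ∎
  where open ≡-Reasoning

pair-ш* : ∀ x y (h : Idx → ℚ) → pair (x ш* y) h ≡ pair x (λ s → pair y (λ t → Σш (ρ s) (ρ t) (h ∘ ρ⁻¹)))
pair-ш* x y h = trans (pair-lin _ x h) (pair-ext x (λ s → trans (pair-lin (shB s) y h) (pair-ext y (λ t → pair-shB s t h))))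

pair-ш⊗ : ∀ X Y (h : Idx × Idx → ℚ) → pair (X ш⊗ Y) h ≡ pair X (λ ab → pair Y (λ cd → Σш⊗ (h ∘ ρ⁻¹²) (ρ² ab) (ρ² cd)))
pair-ш⊗ X Y h = trans (pair-lin _ X h) (pair-ext X (λ ab → trans (pair-lin _ Y h) (pair-ext Y (λ cd →
  trans (pair-⊗ (shB (proj₁ ab) (proj₁ cd)) (shB (proj₂ ab) (proj₂ cd)) h)
        (trans (pair-shB (proj₁ ab) (proj₁ cd) _) (Σш-ext (ρ (proj₁ ab)) (ρ (proj₁ cd)) (λ x → pair-shB (proj₂ ab) (proj₂ cd) _)))))))

Σш-ρ∘ρ⁻¹ : ∀ {u v} → Regular u → Regular v → ∀ (f : Word → ℚ) → Σш u v (λ w → f (ρ (ρ⁻¹ w))) ≡ Σш u v f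
Σш-ρ∘ρ⁻¹ {u} {v} ru rv f = Σш-supp u v (sh-regular ru rv) (λ w rw → cong f (ρ∘ρ⁻¹ rw))

Δrec-𝟏 : Δrec 𝟏 ≋ basis (𝟏 , 𝟏)
Δrec-𝟏 h = trans (pair-Δrec [] h) (trans (Σdec-[] _) (trans (pair-basis [] _) (sym (pair-basis ([] , []) h))))

x₁^ : ℕ → Word
x₁^ k = replicate k x₁

Σlist-applyUpTo : ∀ n (f : ℕ → A) g → Σlist (applyUpTo f n) g ≡ Σlist (upTo n) (g ∘ f)
Σlist-applyUpTo zero f g = refl
Σlist-applyUpTo (suc n) f g =
  cong (g (f 0) ℚ.+_) (trans (Σlist-applyUpTo n (f ∘ suc) g) (sym (Σlist-applyUpTo n suc (g ∘ f))))

Σdec-x₁^ : ∀ k F → Σdec (x₁^ k) F ≡ Σlist (upTo (suc k)) (λ j → F (x₁^ j , x₁^ (k ∸ j)))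
Σdec-x₁^ zero F = trans (Σdec-[] F) (sym (QP.+-identityʳ _))
Σdec-x₁^ (suc k) F = trans (Σdec-∷ x₁ (x₁^ k) F) (cong (F ([] , x₁^ (suc k)) ℚ.+_)
  (trans (Σdec-x₁^ k (λ p → F (x₁ ∷ proj₁ p , proj₂ p))) (sym (Σlist-applyUpTo (suc k) suc (λ j → F (x₁^ j , x₁^ (suc k ∸ j)))))))

regular-x₁^ : ∀ k → Regular (x₁^ k)
regular-x₁^ zero = []ᴿ
regular-x₁^ (suc k) = regular-x₁∷ (regular-x₁^ k)

ρ-ones : ∀ k → ρ (ones k) ≡ x₁^ k
ρ-ones zero = refl
ρ-ones (suc k) = cong (x₁ ∷_) (ρ-ones k)

ρ⁻¹-x₁^ : ∀ k → ρ⁻¹ (x₁^ k) ≡ ones k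
ρ⁻¹-x₁^ k = trans (cong ρ⁻¹ (sym (ρ-ones k))) (ρ⁻¹∘ρ (ones k))

Δrec-ones : ∀ k → Δrec (ones k) ≋ map (λ j → (1ℚ , (ones j , ones (k ∸ j)))) (upTo (suc k))
Δrec-ones k h = begin
    pair (Δrec (ones k)) h
  ≡⟨ pair-Δrec (ones k) h ⟩
    ΣΔ (ρ (ones k)) (h ∘ ρ⁻¹²)
  ≡⟨ cong (λ z → ΣΔ z (h ∘ ρ⁻¹²)) (ρ-ones k) ⟩
    Σdec (x₁^ k) (λ p → pair (reg (proj₁ p)) (λ a → h (ρ⁻¹² (a , proj₂ p))))
  ≡⟨ Σdec-x₁^ k _ ⟩
    Σlist (upTo (suc k)) (λ j → pair (reg (x₁^ j)) (λ a → h (ρ⁻¹² (a , x₁^ (k ∸ j)))))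
  ≡⟨ Σlist-ext (upTo (suc k)) (λ j → trans (pair-reg-regular (regular-x₁^ j) _) (cong₂ (λ z t → h (z , t)) (ρ⁻¹-x₁^ j) (ρ⁻¹-x₁^ (k ∸ j)))) ⟩
    Σlist (upTo (suc k)) (λ j → h (ones j , ones (k ∸ j)))
  ≡⟨ sym (trans (cong (λ z → pair z h) (LP.map-∘ (upTo (suc k)))) (trans (pair-formalSum _ h) (Σlist-map _ (upTo (suc k)) h))) ⟩
    pair (map (λ j → (1ℚ , (ones j , ones (k ∸ j)))) (upTo (suc k))) h
  ∎
  where open ≡-Reasoning

coderivationD : ℕ → Idx × Idx → 𝓗⊗𝓗
coderivationD n p = (basis ⊙D (+ n)) p ⊕ D⊗id (+ n) p

pair-coderivationD : ∀ n (h : Idx × Idx → ℚ) x y → Regular x → Regular y →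
  pair (coderivationD n (ρ⁻¹ x , ρ⁻¹ y)) h ≡ θʳ⊗ n (h ∘ ρ⁻¹²) (x , y) ℚ.- θʳ⊗ (n ∸ 1) (h ∘ ρ⁻¹²) (x , y)
pair-coderivationD n h x y rx ry = begin
    pair ((basis (ρ⁻¹ x) ⊗ᵥ D j (ρ⁻¹ y)) ⊕ (D (+ n) (ρ⁻¹ x) ⊗ᵥ basis (ρ⁻¹ y))) h
  ≡⟨ pair-++ (basis (ρ⁻¹ x) ⊗ᵥ D j (ρ⁻¹ y)) _ h ⟩
    pair (basis (ρ⁻¹ x) ⊗ᵥ D j (ρ⁻¹ y)) h ℚ.+ pair (D (+ n) (ρ⁻¹ x) ⊗ᵥ basis (ρ⁻¹ y)) h
  ≡⟨ cong₂ ℚ._+_ right left ⟩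
    (R (n ∸ #x₁ x) ℚ.- R (n ∸ #x₁ x ∸ 1)) ℚ.+ (L n ℚ.- L (n ∸ 1))
  ≡⟨ cong (λ m → (R (n ∸ #x₁ x) ℚ.- R m) ℚ.+ (L n ℚ.- L (n ∸ 1))) (∸-swap n (#x₁ x)) ⟩
    (R (n ∸ #x₁ x) ℚ.- R (n ∸ 1 ∸ #x₁ x)) ℚ.+ (L n ℚ.- L (n ∸ 1))
  ≡⟨ solve 4 (λ a b c d → (a :- b) :+ (c :- d) := (a :+ c) :- (b :+ d)) refl (R (n ∸ #x₁ x)) (R (n ∸ 1 ∸ #x₁ x)) (L n) (L (n ∸ 1)) ⟩
    θʳ⊗ n H (x , y) ℚ.- θʳ⊗ (n ∸ 1) H (x , y)
  ∎
  where
  open ≡-Reasoning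
  H = h ∘ ρ⁻¹²
  j = (+ n) ℤ.- (+ dep (ρ⁻¹ x))
  R = λ m → θʳ m y (λ y' → H (x , y'))
  L = λ m → θʳ m x (λ x' → H (x' , y))
  ∸-swap : ∀ n c → n ∸ c ∸ 1 ≡ n ∸ 1 ∸ c
  ∸-swap n c = trans (NP.∸-+-assoc n c 1) (trans (cong (n ∸_) (NP.+-comm c 1)) (sym (NP.∸-+-assoc n 1 c)))
  toℕ₀-j : toℕ₀ j ≡ n ∸ #x₁ x
  toℕ₀-j = trans (toℕ₀-sub n (dep (ρ⁻¹ x))) (cong (n ∸_) (dep-ρ⁻¹ x))
  right : pair (basis (ρ⁻¹ x) ⊗ᵥ D j (ρ⁻¹ y)) h ≡ R (n ∸ #x₁ x) ℚ.- R (n ∸ #x₁ x ∸ 1)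
  right = trans (pair-⊗ (basis (ρ⁻¹ x)) (D j (ρ⁻¹ y)) h) (trans (pair-basis (ρ⁻¹ x) _) (trans (D-via-θ j (ρ⁻¹ y) _)
    (cong₂ (λ m z → θʳ m z (λ y' → H (x , y')) ℚ.- θʳ (m ∸ 1) z (λ y' → H (x , y'))) toℕ₀-j (ρ∘ρ⁻¹ ry))))
  left : pair (D (+ n) (ρ⁻¹ x) ⊗ᵥ basis (ρ⁻¹ y)) h ≡ L n ℚ.- L (n ∸ 1)
  left = trans (pair-⊗ (D (+ n) (ρ⁻¹ x)) (basis (ρ⁻¹ y)) h) (trans (pair-ext (D (+ n) (ρ⁻¹ x)) (λ a' → pair-basis (ρ⁻¹ y) _))
    (trans (D-via-θ (+ n) (ρ⁻¹ x) _) (cong (λ z → θʳ n z (λ x' → H (x' , y)) ℚ.- θʳ (n ∸ 1) z (λ x' → H (x' , y))) (ρ∘ρ⁻¹ rx))))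

-- δₙ (ρ s) = Σ_{i ≤ n} sᵢ [.., sᵢ + 1, ..], so Dₙ isolates the n-th bump of s.
pair-Δrec-bump : ∀ s (i : Fin (dep s)) (h : Idx × Idx → ℚ) → let n = suc (toℕ i) in
  nat (val (lookup s i)) ℚ.* pair (Δrec (updateAt s i suc)) h ≡
  θʳ n (ρ s) (λ y → ΣΔ y (h ∘ ρ⁻¹²)) ℚ.- θʳ (n ∸ 1) (ρ s) (λ y → ΣΔ y (h ∘ ρ⁻¹²))
pair-Δrec-bump s i h = trans (sym (D-bump s i h')) (trans (D-via-θ (+ n) s h') (cong₂ ℚ._-_ (via-ΣΔ n) (via-ΣΔ (n ∸ 1))))
  where
  n = suc (toℕ i)
  h' = λ t → pair (Δrec t) h
  via-ΣΔ : ∀ m → θʳ m (ρ s) (h' ∘ ρ⁻¹) ≡ θʳ m (ρ s) (λ y → ΣΔ y (h ∘ ρ⁻¹²))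
  via-ΣΔ m = pair-ext (θ m (ρ s)) (λ z → pair-supp (reg-supp z) (λ y ry → pair-Δrec-regular (proj₁ ry) h))

Δrec-bump : ∀ s (i : Fin (dep s)) →
  Δrec (updateAt s i suc) ≋ scale ((+ 1) ℚ./ val (lookup s i)) (lin (coderivationD (suc (toℕ i))) (Δrec s))
Δrec-bump s i h = sym (begin
    pair (scale (inv e) (lin (coderivationD n) (Δrec s))) h
  ≡⟨ trans (pair-scale (inv e) _ h) (cong (inv e ℚ.*_) (pair-lin-on-Δrec (coderivationD n) s h)) ⟩
    inv e ℚ.* ΣΔ (ρ s) (λ xy → pair (coderivationD n (ρ⁻¹² xy)) h)
  ≡⟨ cong (inv e ℚ.*_) (trans (ΣΔ-supp (ρ-regular s) (λ x y rx ry → pair-coderivationD n h x y rx ry)) (ΣΔ-minus (ρ s) _ _)) ⟩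
    inv e ℚ.* (ΣΔ (ρ s) (θʳ⊗ n H) ℚ.- ΣΔ (ρ s) (θʳ⊗ (n ∸ 1) H))
  ≡⟨ cong (inv e ℚ.*_) (sym (cong₂ ℚ._-_ (θ-ΣΔ n (ρ s) (ρ-regular s) H) (θ-ΣΔ (n ∸ 1) (ρ s) (ρ-regular s) H))) ⟩
    inv e ℚ.* (θʳ n (ρ s) (λ y → ΣΔ y H) ℚ.- θʳ (n ∸ 1) (ρ s) (λ y → ΣΔ y H))
  ≡⟨ cong (inv e ℚ.*_) (sym (pair-Δrec-bump s i h)) ⟩
    inv e ℚ.* (nat (suc e) ℚ.* pair (Δrec (updateAt s i suc)) h)
  ≡⟨ sym (QP.*-assoc (inv e) (nat (suc e)) _) ⟩
    (inv e ℚ.* nat (suc e)) ℚ.* pair (Δrec (updateAt s i suc)) h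
  ≡⟨ trans (cong (ℚ._* pair (Δrec (updateAt s i suc)) h) (inv-nat e)) (QP.*-identityˡ _) ⟩
    pair (Δrec (updateAt s i suc)) h
  ∎)
  where
  open ≡-Reasoning
  n = suc (toℕ i)
  e = lookup s i
  H = h ∘ ρ⁻¹²

Δrec-isΔrec : IsΔrec Δrec
Δrec-isΔrec = ≋⇒≈ _≟ᵢ₂_ Δrec-𝟏 , (λ k _ → ≋⇒≈ _≟ᵢ₂_ (Δrec-ones k)) , (λ s i → ≋⇒≈ _≟ᵢ₂_ (Δrec-bump s i))

-- Σ (sᵢ - 1), the number of applications of (c) leading from some [{1}^k] to s
excess : Idx → ℕ
excess [] = 0
excess (e ∷ s) = e + excess s

data BumpView : Idx → Set where
  ones-view : ∀ k → BumpView (ones k)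
  bump-view : ∀ s₀ (i : Fin (dep s₀)) → BumpView (updateAt s₀ i suc)

bumpView : ∀ s → BumpView s
bumpView [] = ones-view 0
bumpView (suc e ∷ s) = bump-view (e ∷ s) fz
bumpView (zero ∷ s) with bumpView s
... | ones-view k = ones-view (suc k)
... | bump-view s₀ i = bump-view (0 ∷ s₀) (fs i)

excess-bump : ∀ s (i : Fin (dep s)) → excess (updateAt s i suc) ≡ suc (excess s)
excess-bump (e ∷ s) fz = refl
excess-bump (e ∷ s) (fs i) = trans (cong (e ℕ.+_) (excess-bump s i)) (NP.+-suc e (excess s))

Δrec-unique : ∀ (Δ' : Idx → 𝓗⊗𝓗) → IsΔrec Δ' → ∀ s → Δ' s ≈₂ Δrec s
Δrec-unique Δ' (Δ'-𝟏 , Δ'-ones , Δ'-bump) s = ≋⇒≈ _≟ᵢ₂_ (by-excess (excess s) s refl)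
  where
  agree-ones : ∀ k → Δ' (ones k) ≋ Δrec (ones k)
  agree-ones zero = ≋-trans (≈⇒≋ _≟ᵢ₂_ Δ'-𝟏) (≋-sym Δrec-𝟏)
  agree-ones (suc k) = ≋-trans (≈⇒≋ _≟ᵢ₂_ (Δ'-ones (suc k) (ℕ.s≤s ℕ.z≤n))) (≋-sym (Δrec-ones (suc k)))
  by-excess : ∀ N s → excess s ≡ N → Δ' s ≋ Δrec s
  by-excess N s eq with bumpView s
  ... | ones-view k = agree-ones k
  by-excess zero _ eq | bump-view s₀ i with trans (sym (excess-bump s₀ i)) eq
  ... | ()
  by-excess (suc N) _ eq | bump-view s₀ i =
    ≋-trans (≈⇒≋ _≟ᵢ₂_ (Δ'-bump s₀ i))
      (≋-trans (scale-cong (inv (lookup s₀ i)) (lin-cong {f = coderivationD (suc (toℕ i))} (λ _ → ≋-refl) (by-excess N s₀ (NP.suc-injective (trans (sym (excess-bump s₀ i)) eq)))))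
               (≋-sym (Δrec-bump s₀ i)))

ш*-assoc : ∀ x y z → ((x ш* y) ш* z) ≋ (x ш* (y ш* z))
ш*-assoc x y z h = begin
    pair ((x ш* y) ш* z) h
  ≡⟨ trans (pair-ш* (x ш* y) z h) (pair-ш* x y _) ⟩
    pair x (λ s → pair y (λ t → Σш (ρ s) (ρ t) (λ w → pair z (λ r → Σш (ρ (ρ⁻¹ w)) (ρ r) h'))))
  ≡⟨ pair-ext x (λ s → pair-ext y (λ t → trans (Σш-ρ∘ρ⁻¹ (ρ-regular s) (ρ-regular t) (λ w → pair z (λ r → Σш w (ρ r) h')))
       (trans (Σш-pair-swap (ρ s) (ρ t) z (λ w r → Σш w (ρ r) h')) (pair-ext z (λ r → Σш-assoc (ρ s) (ρ t) (ρ r) h'))))) ⟩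
    pair x (λ s → pair y (λ t → pair z (λ r → Σш (ρ t) (ρ r) (λ w → Σш (ρ s) w h'))))
  ≡⟨ sym (trans (pair-ш* x (y ш* z) h) (pair-ext x (λ s → trans (pair-ш* y z _)
       (pair-ext y (λ t → pair-ext z (λ r → Σш-ρ∘ρ⁻¹ (ρ-regular t) (ρ-regular r) (λ w → Σш (ρ s) w h'))))))) ⟩
    pair (x ш* (y ш* z)) h
  ∎
  where
  open ≡-Reasoning
  h' = h ∘ ρ⁻¹

ш*-identityˡ : ∀ x → (basis 𝟏 ш* x) ≋ x
ш*-identityˡ x h = trans (pair-ш* (basis []) x h)
  (trans (pair-basis [] _) (pair-ext x (λ t → trans (Σш-[]ˡ (ρ t) (h ∘ ρ⁻¹)) (cong h (ρ⁻¹∘ρ t)))))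

ш*-identityʳ : ∀ x → (x ш* basis 𝟏) ≋ x
ш*-identityʳ x h = trans (pair-ш* x (basis []) h)
  (pair-ext x (λ s → trans (pair-basis [] _) (trans (Σш-[]ʳ (ρ s) (h ∘ ρ⁻¹)) (cong h (ρ⁻¹∘ρ s)))))

Δrec-coassoc : ∀ s → assocL (lin (Δrec ⊗ₘ basis) (Δrec s)) ≋ lin (basis ⊗ₘ Δrec) (Δrec s)
Δrec-coassoc s h = begin
    pair (assocL (lin (Δrec ⊗ₘ basis) (Δrec s))) h
  ≡⟨ trans (pair-map reassoc _ h) (pair-lin-on-Δrec (Δrec ⊗ₘ basis) s _) ⟩
    ΣΔ w (λ xy → pair (Δrec (ρ⁻¹ (proj₁ xy)) ⊗ᵥ basis (ρ⁻¹ (proj₂ xy))) (h ∘ reassoc))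
  ≡⟨ ΣΔ-supp rw (λ x y rx ry → trans (pair-⊗ (Δrec (ρ⁻¹ x)) (basis (ρ⁻¹ y)) _)
       (trans (pair-ext (Δrec (ρ⁻¹ x)) (λ a → pair-basis (ρ⁻¹ y) _)) (pair-Δrec-regular rx _))) ⟩
    ΣΔ w (λ xy → ΣΔ (proj₁ xy) (λ cd → F (proj₁ cd) (proj₂ cd) (proj₂ xy)))
  ≡⟨ ΣΔ-coassoc w F ⟩
    ΣΔ w (λ xy → ΣΔ (proj₂ xy) (λ cd → F (proj₁ xy) (proj₁ cd) (proj₂ cd)))
  ≡⟨ sym (ΣΔ-supp rw (λ x y rx ry → trans (pair-⊗ (basis (ρ⁻¹ x)) (Δrec (ρ⁻¹ y)) h)
       (trans (pair-basis (ρ⁻¹ x) _) (pair-Δrec-regular ry _)))) ⟩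
    ΣΔ w (λ xy → pair (basis (ρ⁻¹ (proj₁ xy)) ⊗ᵥ Δrec (ρ⁻¹ (proj₂ xy))) h)
  ≡⟨ sym (pair-lin-on-Δrec (basis ⊗ₘ Δrec) s h) ⟩
    pair (lin (basis ⊗ₘ Δrec) (Δrec s)) h
  ∎
  where
  open ≡-Reasoning
  w = ρ s
  rw = ρ-regular s
  reassoc : (Idx × Idx) × Idx → Idx × Idx × Idx
  reassoc ((a , b) , c) = (a , (b , c))
  F = λ a₁ a₂ b → h (ρ⁻¹ a₁ , (ρ⁻¹ a₂ , ρ⁻¹ b))

pair-reg-ε₀ : ∀ u c → pair (reg u) (λ a → ε₀ a ℚ.* c) ≡ ε₀ u ℚ.* c
pair-reg-ε₀ [] c = pair-basis [] (λ a → ε₀ a ℚ.* c)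
pair-reg-ε₀ (b ∷ u) c = begin
    pair (reg (b ∷ u)) (λ a → ε₀ a ℚ.* c)  ≡⟨ pair-supp (reg-supp (b ∷ u)) (λ a ra → nonempty a (proj₁ (proj₂ ra))) ⟩
    pair (reg (b ∷ u)) (λ _ → 0ℚ)          ≡⟨ pair-0 (reg (b ∷ u)) ⟩
    0ℚ                                     ≡⟨ sym (QP.*-zeroˡ c) ⟩
    0ℚ ℚ.* c                               ∎
  where
  open ≡-Reasoning
  nonempty : ∀ a → length a ≡ suc (length u) → ε₀ a ℚ.* c ≡ 0ℚ
  nonempty (_ ∷ _) _ = QP.*-zeroˡ c

Δrec-counitˡ : ∀ s → lin (λ ab → scale (ε (proj₁ ab)) (basis (proj₂ ab))) (Δrec s) ≋ basis s
Δrec-counitˡ s h = begin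
    pair (lin (λ ab → scale (ε (proj₁ ab)) (basis (proj₂ ab))) (Δrec s)) h
  ≡⟨ pair-lin-on-Δrec (λ ab → scale (ε (proj₁ ab)) (basis (proj₂ ab))) s h ⟩
    ΣΔ (ρ s) (λ xy → pair (scale (ε (ρ⁻¹ (proj₁ xy))) (basis (ρ⁻¹ (proj₂ xy)))) h)
  ≡⟨ ΣΔ-supp (ρ-regular s) (λ x y rx ry → trans (pair-scale (ε (ρ⁻¹ x)) (basis (ρ⁻¹ y)) h) (cong₂ ℚ._*_ (ε-ρ⁻¹ rx) (pair-basis (ρ⁻¹ y) h))) ⟩
    Σdec (ρ s) (λ p → pair (reg (proj₁ p)) (λ a → ε₀ a ℚ.* h (ρ⁻¹ (proj₂ p))))
  ≡⟨ Σdec-ext (ρ s) (λ p → pair-reg-ε₀ (proj₁ p) _) ⟩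
    Σdec (ρ s) (λ p → ε₀ (proj₁ p) ℚ.* h (ρ⁻¹ (proj₂ p)))
  ≡⟨ Σdec-counitˡ (ρ s) (h ∘ ρ⁻¹) ⟩
    h (ρ⁻¹ (ρ s))
  ≡⟨ trans (cong h (ρ⁻¹∘ρ s)) (sym (pair-basis s h)) ⟩
    pair (basis s) h
  ∎
  where open ≡-Reasoning

Δrec-counitʳ : ∀ s → lin (λ ab → scale (ε (proj₂ ab)) (basis (proj₁ ab))) (Δrec s) ≋ basis s
Δrec-counitʳ s h = begin
    pair (lin (λ ab → scale (ε (proj₂ ab)) (basis (proj₁ ab))) (Δrec s)) h
  ≡⟨ pair-lin-on-Δrec (λ ab → scale (ε (proj₂ ab)) (basis (proj₁ ab))) s h ⟩
    ΣΔ (ρ s) (λ xy → pair (scale (ε (ρ⁻¹ (proj₂ xy))) (basis (ρ⁻¹ (proj₁ xy)))) h)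
  ≡⟨ ΣΔ-supp (ρ-regular s) (λ x y rx ry → trans (pair-scale (ε (ρ⁻¹ y)) (basis (ρ⁻¹ x)) h) (cong₂ ℚ._*_ (ε-ρ⁻¹ ry) (pair-basis (ρ⁻¹ x) h))) ⟩
    Σdec (ρ s) (λ p → pair (reg (proj₁ p)) (λ a → ε₀ (proj₂ p) ℚ.* h (ρ⁻¹ a)))
  ≡⟨ Σdec-ext (ρ s) (λ p → pair-* (ε₀ (proj₂ p)) (reg (proj₁ p)) (h ∘ ρ⁻¹)) ⟩
    Σdec (ρ s) (λ p → ε₀ (proj₂ p) ℚ.* pair (reg (proj₁ p)) (h ∘ ρ⁻¹))
  ≡⟨ Σdec-counitʳ (ρ s) (λ u → pair (reg u) (h ∘ ρ⁻¹)) ⟩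
    pair (reg (ρ s)) (h ∘ ρ⁻¹)
  ≡⟨ pair-reg-regular (ρ-regular s) (h ∘ ρ⁻¹) ⟩
    h (ρ⁻¹ (ρ s))
  ≡⟨ trans (cong h (ρ⁻¹∘ρ s)) (sym (pair-basis s h)) ⟩
    pair (basis s) h
  ∎
  where open ≡-Reasoning

Δrec-ш* : ∀ x y → lin Δrec (x ш* y) ≋ (lin Δrec x ш⊗ lin Δrec y)
Δrec-ш* x y h = begin
    pair (lin Δrec (x ш* y)) h
  ≡⟨ trans (pair-lin Δrec (x ш* y) h) (pair-ш* x y _) ⟩
    pair x (λ s → pair y (λ t → Σш (ρ s) (ρ t) (λ w → pair (Δrec (ρ⁻¹ w)) h)))
  ≡⟨ pair-ext x (λ s → pair-ext y (λ t →
       trans (Σш-supp (ρ s) (ρ t) (sh-regular (ρ-regular s) (ρ-regular t)) (λ w rw → pair-Δrec-regular rw h)) (ΣΔ-Σш (ρ s) (ρ t) H))) ⟩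
    pair x (λ s → pair y (λ t → ΣΔ (ρ s) (λ p → ΣΔ (ρ t) (Σш⊗ H p))))
  ≡⟨ pair-ext x (λ s → sym (ΣΔ-pair-swap (ρ s) y _)) ⟩
    pair x (λ s → ΣΔ (ρ s) (λ p → pair y (λ t → ΣΔ (ρ t) (Σш⊗ H p))))
  ≡⟨ pair-ext x (λ s → ΣΔ-supp (ρ-regular s) (λ a b ra rb → pair-ext y (λ t → ΣΔ-supp (ρ-regular t) (λ c d rc rd →
       sym (cong₂ (Σш⊗ H) (cong₂ _,_ (ρ∘ρ⁻¹ ra) (ρ∘ρ⁻¹ rb)) (cong₂ _,_ (ρ∘ρ⁻¹ rc) (ρ∘ρ⁻¹ rd))))))) ⟩
    pair x (λ s → ΣΔ (ρ s) (λ p → pair y (λ t → ΣΔ (ρ t) (λ r → Σш⊗ H (ρ² (ρ⁻¹² p)) (ρ² (ρ⁻¹² r))))))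
  ≡⟨ sym (trans (pair-ш⊗ (lin Δrec x) (lin Δrec y) h) (trans (pair-lin-Δrec x _)
       (pair-ext x (λ s → ΣΔ-ext (ρ s) (λ p → pair-lin-Δrec y _))))) ⟩
    pair (lin Δrec x ш⊗ lin Δrec y) h
  ∎
  where
  open ≡-Reasoning
  H = h ∘ ρ⁻¹²

Σш-ε₀ : ∀ u v → Σш u v ε₀ ≡ ε₀ u ℚ.* ε₀ v
Σш-ε₀ [] v = trans (Σш-[]ˡ v ε₀) (sym (QP.*-identityˡ (ε₀ v)))
Σш-ε₀ (a ∷ u) [] = Σш-[]ʳ (a ∷ u) ε₀
Σш-ε₀ (a ∷ u) (b ∷ v) = trans (Σш-∷ a u b v ε₀) (cong₂ ℚ._+_ (Σш-0 u (b ∷ v)) (Σш-0 (a ∷ u) v))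

ε₀-ρ : ∀ s → ε₀ (ρ s) ≡ ε s
ε₀-ρ s = trans (sym (ε-ρ⁻¹ (ρ-regular s))) (cong ε (ρ⁻¹∘ρ s))

εₗ-ш* : ∀ x y → εₗ (x ш* y) ≡ εₗ x ℚ.* εₗ y
εₗ-ш* x y = begin
    εₗ (x ш* y)                                       ≡⟨ trans (sumℚ-pair (x ш* y) ε) (pair-ш* x y ε) ⟩
    pair x (λ s → pair y (λ t → Σш (ρ s) (ρ t) (ε ∘ ρ⁻¹)))
      ≡⟨ pair-ext x (λ s → pair-ext y (λ t → trans (Σш-supp (ρ s) (ρ t) (sh-regular (ρ-regular s) (ρ-regular t)) (λ w rw → ε-ρ⁻¹ rw))
           (trans (Σш-ε₀ (ρ s) (ρ t)) (cong₂ ℚ._*_ (ε₀-ρ s) (ε₀-ρ t))))) ⟩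
    pair x (λ s → pair y (λ t → ε s ℚ.* ε t))          ≡⟨ pair-ext x (λ s → trans (pair-* (ε s) y ε) (QP.*-comm (ε s) (pair y ε))) ⟩
    pair x (λ s → pair y ε ℚ.* ε s)                    ≡⟨ trans (pair-* (pair y ε) x ε) (QP.*-comm (pair y ε) (pair x ε)) ⟩
    pair x ε ℚ.* pair y ε                              ≡⟨ sym (cong₂ ℚ._*_ (sumℚ-pair x ε) (sumℚ-pair y ε)) ⟩
    εₗ x ℚ.* εₗ y                                      ∎
  where open ≡-Reasoning

shB-homogeneous : ∀ s t w → ¬ (coef _≟ᵢ_ w (shB s t) ≡ 0ℚ) → wt w ≡ wt s + wt t
shB-homogeneous s t = coef≢0⇒supported _≟ᵢ_ (AllP.map⁺ (All.zipWith weight (sh-regular (ρ-regular s) (ρ-regular t) , sh-additive (ρ s) (ρ t))))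
  where
  weight : ∀ {v} → Regular v × Additive (ρ s) (ρ t) v → wt (ρ⁻¹ v) ≡ wt s + wt t
  weight (rv , l , _) = trans (wt-ρ⁻¹ rv) (trans l (cong₂ _+_ (length-ρ s) (length-ρ t)))

ΔTerm : Word → Word × Word → Set
ΔTerm w (x , y) = Regular x × Regular y × (length x + length y ≡ length w)

Δʷ-supp : ∀ {w} → Regular w → Supported (ΔTerm w) (Δʷ w)
Δʷ-supp {w} rw = supp-lin _ (AllP.map⁺ (dec-++ w)) (λ p e →
  All.map (λ { {x , y} (rx , refl) → proj₁ rx , regular-suffix (proj₁ p) (proj₂ p) (subst Regular (sym e) rw) ,
      trans (cong (_+ length (proj₂ p)) (proj₁ (proj₂ rx))) (trans (sym (LP.length-++ (proj₁ p))) (cong length e)) })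
   (supp-⊗ {Q = λ y → y ≡ proj₂ p} (reg-supp (proj₁ p)) (refl ∷ [])))

Δrec-homogeneous : ∀ s a b → ¬ (coef _≟ᵢ₂_ (a , b) (Δrec s) ≡ 0ℚ) → wt a + wt b ≡ wt s
Δrec-homogeneous s a b = coef≢0⇒supported _≟ᵢ₂_ {P = λ ab → wt (proj₁ ab) + wt (proj₂ ab) ≡ wt s}
  (AllP.map⁺ (All.map (λ { {q , (x , y)} (rx , ry , l) → trans (cong₂ _+_ (wt-ρ⁻¹ rx) (wt-ρ⁻¹ ry)) (trans l (length-ρ s)) })
    (Δʷ-supp (ρ-regular s)))) (a , b)

ε-homogeneous : ∀ s → ¬ (ε s ≡ 0ℚ) → wt s ≡ 0
ε-homogeneous [] _ = refl
ε-homogeneous (e ∷ s) ε≢0 = ⊥-elim (ε≢0 refl)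

wt≡0⇒𝟏 : ∀ s → wt s ≡ 0 → s ≡ 𝟏
wt≡0⇒𝟏 [] _ = refl

Δrec-isConnectedBialgebra : IsConnectedBialgebra Δrec
Δrec-isConnectedBialgebra =
  (λ x y z → ≋⇒≈ _≟ᵢ_ (ш*-assoc x y z)) , (λ x → ≋⇒≈ _≟ᵢ_ (ш*-identityˡ x)) , (λ x → ≋⇒≈ _≟ᵢ_ (ш*-identityʳ x)) ,
  (λ s → ≋⇒≈ _≟ᵢ₃_ (Δrec-coassoc s)) , (λ s → ≋⇒≈ _≟ᵢ_ (Δrec-counitˡ s)) , (λ s → ≋⇒≈ _≟ᵢ_ (Δrec-counitʳ s)) ,
  (λ x y → ≋⇒≈ _≟ᵢ₂_ (Δrec-ш* x y)) , ≋⇒≈ _≟ᵢ₂_ Δrec-𝟏 , εₗ-ш* , refl ,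
  shB-homogeneous , Δrec-homogeneous , ε-homogeneous , wt≡0⇒𝟏

-- the antipode w ↦ (-1)^|w| reverse w of the shuffle algebra, followed by reg
antipode : Idx → 𝓗
antipode s = map (λ p → (proj₁ p , ρ⁻¹ (proj₂ p))) (lin reg (scale (sgn (length (ρ s))) (basis (reverse (ρ s)))))

pair-antipode : ∀ {x} → Regular x → ∀ (f : Idx → ℚ) → pair (antipode (ρ⁻¹ x)) f ≡ sgn (length x) ℚ.* pair (reg (reverse x)) (f ∘ ρ⁻¹)
pair-antipode {x} rx f = begin
    pair (antipode (ρ⁻¹ x)) f
  ≡⟨ trans (pair-map ρ⁻¹ _ f) (pair-lin reg _ (f ∘ ρ⁻¹)) ⟩
    pair (scale (sgn (length x')) (basis (reverse x'))) (λ z → pair (reg z) (f ∘ ρ⁻¹))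
  ≡⟨ trans (pair-scale (sgn (length x')) (basis (reverse x')) _) (cong (sgn (length x') ℚ.*_) (pair-basis (reverse x') _)) ⟩
    sgn (length x') ℚ.* pair (reg (reverse x')) (f ∘ ρ⁻¹)
  ≡⟨ cong (λ z → sgn (length z) ℚ.* pair (reg (reverse z)) (f ∘ ρ⁻¹)) (ρ∘ρ⁻¹ rx) ⟩
    sgn (length x) ℚ.* pair (reg (reverse x)) (f ∘ ρ⁻¹)
  ∎
  where
  open ≡-Reasoning
  x' = ρ (ρ⁻¹ x)

pair-ε-𝟏 : ∀ s h → ε₀ (ρ s) ℚ.* pair (reg []) (h ∘ ρ⁻¹) ≡ pair (scale (ε s) (basis 𝟏)) h
pair-ε-𝟏 s h = begin
    ε₀ (ρ s) ℚ.* pair (reg []) (h ∘ ρ⁻¹)                       ≡⟨ cong₂ ℚ._*_ (ε₀-ρ s) (pair-basis [] _) ⟩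
    ε s ℚ.* h []                                               ≡⟨ sym (trans (pair-scale (ε s) (basis []) h) (cong (ε s ℚ.*_) (pair-basis [] h))) ⟩
    pair (scale (ε s) (basis 𝟏)) h                            ∎
  where open ≡-Reasoning

antipodeˡ : ∀ s → lin (λ ab → antipode (proj₁ ab) ш* basis (proj₂ ab)) (Δrec s) ≋ scale (ε s) (basis 𝟏)
antipodeˡ s h = begin
    pair (lin (λ ab → antipode (proj₁ ab) ш* basis (proj₂ ab)) (Δrec s)) h
  ≡⟨ pair-lin-on-Δrec (λ ab → antipode (proj₁ ab) ш* basis (proj₂ ab)) s h ⟩
    ΣΔ w (λ xy → pair (antipode (ρ⁻¹ (proj₁ xy)) ш* basis (ρ⁻¹ (proj₂ xy))) h)
  ≡⟨ ΣΔ-supp rw (λ x y rx ry → trans (pair-ш* _ _ h) (trans (pair-ext (antipode (ρ⁻¹ x)) (λ s' → pair-basis (ρ⁻¹ y) _))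
       (trans (pair-antipode rx _) (cong (sgn (length x) ℚ.*_) (pair-supp (reg-supp (reverse x)) (λ z rz →
          cong₂ (λ a b → Σш a b h') (ρ∘ρ⁻¹ (proj₁ rz)) (ρ∘ρ⁻¹ ry))))))) ⟩
    Σdec w (λ p → pair (reg (proj₁ p)) (λ x → sgn (length x) ℚ.* pair (reg (reverse x)) (ψ (proj₂ p))))
  ≡⟨ Σdec-ext w (λ p → reg-antipode (proj₁ p) (ψ (proj₂ p))) ⟩
    Σdec w (λ p → sgn (length (proj₁ p)) ℚ.* pair (reg (reverse (proj₁ p))) (ψ (proj₂ p)))
  ≡⟨ Σdec-supp w (λ u v e → cong (sgn (length u) ℚ.*_) (sym (trans (reg-Σш (reverse u) v h')
        (pair-ext (reg (reverse u)) (λ z → pair-reg-regular (regular-suffix u v (subst Regular (sym e) rw)) (λ v' → Σш z v' h')))))) ⟩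
    Σdec w (λ p → sgn (length (proj₁ p)) ℚ.* Σш (reverse (proj₁ p)) (proj₂ p) G)
  ≡⟨ trans (Σdec-antipodeˡ w G) (pair-ε-𝟏 s h) ⟩
    pair (scale (ε s) (basis 𝟏)) h
  ∎
  where
  open ≡-Reasoning
  w = ρ s
  rw = ρ-regular s
  h' = h ∘ ρ⁻¹
  G = λ y → pair (reg y) h'
  ψ = λ (v z : Word) → Σш z v h'

antipodeʳ : ∀ s → lin (λ ab → basis (proj₁ ab) ш* antipode (proj₂ ab)) (Δrec s) ≋ scale (ε s) (basis 𝟏)
antipodeʳ s h = begin
    pair (lin (λ ab → basis (proj₁ ab) ш* antipode (proj₂ ab)) (Δrec s)) h
  ≡⟨ pair-lin-on-Δrec (λ ab → basis (proj₁ ab) ш* antipode (proj₂ ab)) s h ⟩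
    ΣΔ w (λ xy → pair (basis (ρ⁻¹ (proj₁ xy)) ш* antipode (ρ⁻¹ (proj₂ xy))) h)
  ≡⟨ ΣΔ-supp rw (λ x y rx ry → trans (pair-ш* _ _ h) (trans (pair-basis (ρ⁻¹ x) _)
       (trans (pair-antipode ry _) (cong (sgn (length y) ℚ.*_) (pair-supp (reg-supp (reverse y)) (λ z rz →
          cong₂ (λ a b → Σш a b h') (ρ∘ρ⁻¹ rx) (ρ∘ρ⁻¹ (proj₁ rz)))))))) ⟩
    Σdec w (λ p → pair (reg (proj₁ p)) (λ x → sgn (length (proj₂ p)) ℚ.* pair (reg (reverse (proj₂ p))) (λ z → Σш x z h')))
  ≡⟨ Σdec-ext w (λ p → trans (pair-* (sgn (length (proj₂ p))) (reg (proj₁ p)) _)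
        (cong (sgn (length (proj₂ p)) ℚ.*_) (sym (reg-Σш (proj₁ p) (reverse (proj₂ p)) h')))) ⟩
    Σdec w (λ p → sgn (length (proj₂ p)) ℚ.* Σш (proj₁ p) (reverse (proj₂ p)) G)
  ≡⟨ trans (Σdec-antipodeʳ w G) (pair-ε-𝟏 s h) ⟩
    pair (scale (ε s) (basis 𝟏)) h
  ∎
  where
  open ≡-Reasoning
  w = ρ s
  rw = ρ-regular s
  h' = h ∘ ρ⁻¹
  G = λ y → pair (reg y) h'

Δrec-hasAntipode : HasAntipode Δrec
Δrec-hasAntipode = antipode , (λ s → ≋⇒≈ _≟ᵢ_ (antipodeˡ s)) , (λ s → ≋⇒≈ _≟ᵢ_ (antipodeʳ s))

theorem2p5 : Σ (Idx → 𝓗⊗𝓗) λ Δrec →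
    IsΔrec Δrec
    × (∀ (Δ' : Idx → 𝓗⊗𝓗) → IsΔrec Δ' → ∀ s → Δ' s ≈₂ Δrec s)
    × IsConnectedBialgebra Δrec
    × HasAntipode Δrec
theorem2p5 = Δrec , Δrec-isΔrec , Δrec-unique , Δrec-isConnectedBialgebra , Δrec-hasAntipode
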